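{- Let $m\ge 0$ be an integer. Let $A=(a_{ij})$, $B=(b_{ij})$, $C=(c_{ij})$, $D=(d_{ij})$ be $(2m+1)\times(2m+1)$ arrays with rows and columns indexed by $i,j\in\{0,1,\ldots,2m\}$ and entries in $\mathbb{Z}_{4m+2}$ given by $a_{ij}=2(i+j)$, $b_{ij}=c_{ij}=2(i+j)+1$, $d_{ij}=2(i+j)+2$ (all modulo $4m+2$), and let $M_{4m+2}$ be the Latin square of order $4m+2$ formed as the block array $\begin{pmatrix}A&B\\C&D\end{pmatrix}$. Let $M^*_{4m+2}$ be obtained from $M_{4m+2}$ by redefining the four entries $a_{00}=2m+1$, $d_{mm}=2m+1$, $b_{0m}=0$, $c_{m0}=0$. Then $M^*_{4m+2}$ is a near-omniversal Latin square. Moreover, for $m\ge 1$, $M^*_{4m+2}$ has no maximal partial transversal of length $2m+1$.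
   Context: Latin squares are viewed as sets of triples $(r,c,s)$ with $s$ the symbol in cell $(r,c)$. A partial transversal is a set of triples containing at most one triple in each row, at most one in each column, and at most one with each symbol; its length is its number of triples. It is maximal if not contained in a longer partial transversal. A Latin square of order $n$ is near-omniversal if there is exactly one integer $\ell$ with $\lceil n/2\rceil\le\ell\le n$ for which it has no maximal partial transversal of length $\ell$. -}

module Defs where

open import Data.Nat using (ℕ; zero; suc; _+_; _*_; _∸_; _≤_; _<_; _<?_; _≟_; ⌈_/2⌉)
open import Data.Nat.DivMod using (_%_; m%n<n)
open import Data.Fin using (Fin; toℕ; fromℕ<)
open import Data.Bool using (Bool; true; false; if_then_else_; _∧_)
open import Data.Product using (_×_; _,_; Σ; ∃; proj₁; proj₂)
open import Data.List using (List; length; map)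
open import Data.List.Relation.Unary.Unique.Propositional using (Unique)
open import Data.List.Membership.Propositional using (_∈_)
open import Relation.Nullary using (¬_; does)
open import Relation.Binary.PropositionalEquality using (_≡_)
open import Function.Definitions using (Injective)

Square : ℕ → Set
Square n = Fin n → Fin n → Fin n

-- Latin: every symbol at most once per row and per column (for an
-- n×n array over n symbols this is the Latin property).
IsLatin : ∀ {n} → Square n → Set
IsLatin {n} L = (∀ r → Injective _≡_ _≡_ (L r)) × (∀ c → Injective _≡_ _≡_ (λ r → L r c))

-- A set of triples (r,c,L r c) is represented by the list of its cells.
Cell : ℕ → Set
Cell n = Fin n × Fin n

symbolOf : ∀ {n} → Square n → Cell n → Fin n
symbolOf L (r , c) = L r c

IsPartialTransversal : ∀ {n} → Square n → List (Cell n) → Set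
IsPartialTransversal L T =
  Unique (map proj₁ T) × Unique (map proj₂ T) × Unique (map (symbolOf L) T)

_⊆_ : ∀ {n} → List (Cell n) → List (Cell n) → Set
T ⊆ T' = ∀ {x} → x ∈ T → x ∈ T'

IsMaximalPT : ∀ {n} → Square n → List (Cell n) → Set
IsMaximalPT L T = IsPartialTransversal L T ×
  ¬ (Σ (List _) λ T' → IsPartialTransversal L T' × T ⊆ T' × length T < length T')

HasMaximalPTOfLength : ∀ {n} → Square n → ℕ → Set
HasMaximalPTOfLength L ℓ = Σ (List _) λ T → IsMaximalPT L T × length T ≡ ℓ

NearOmniversal : ∀ {n} → Square n → Set
NearOmniversal {n} L = Σ ℕ λ ℓ →
  (⌈ n /2⌉ ≤ ℓ × ℓ ≤ n × ¬ HasMaximalPTOfLength L ℓ) ×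
  (∀ ℓ' → ⌈ n /2⌉ ≤ ℓ' → ℓ' ≤ n → ¬ HasMaximalPTOfLength L ℓ' → ℓ' ≡ ℓ)

-- Order 4m+2 (written 2 + 4*m so that it is visibly nonzero).
ord : ℕ → ℕ
ord m = 2 + 4 * m

_==_ : ℕ → ℕ → Bool
a == b = does (a ≟ b)

_<ᵇ_ : ℕ → ℕ → Bool
a <ᵇ b = does (a <? b)

-- Entry of M*_{4m+2} at natural coordinates (r, c), before reduction mod 4m+2.
-- k = 2m+1; blocks A (r<k,c<k), B (r<k,c≥k), C (r≥k,c<k), D (r≥k,c≥k),
-- with local indices i, j ∈ {0..2m}.
entryℕ : ℕ → ℕ → ℕ → ℕ
entryℕ m r c =
  if r <ᵇ k then
    (if c <ᵇ k
      then (if (r == 0) ∧ (c == 0) then k else 2 * (r + c))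
      else (if (r == 0) ∧ ((c ∸ k) == m) then 0 else 2 * (r + (c ∸ k)) + 1))
  else
    (if c <ᵇ k
      then (if ((r ∸ k) == m) ∧ (c == 0) then 0 else 2 * ((r ∸ k) + c) + 1)
      else (if ((r ∸ k) == m) ∧ ((c ∸ k) == m) then k
            else 2 * ((r ∸ k) + (c ∸ k)) + 2))
  where k = 1 + 2 * m

Mstar : (m : ℕ) → Square (ord m)
Mstar m r c = fromℕ< (m%n<n (entryℕ m (toℕ r) (toℕ c)) (ord m))

module Submission where

-- Write K = 2m + 1 and split rows, columns and symbols of M* into two blocks of K.  Outside the
-- four redefined cells, the symbol in block (p, q) at local position (i, j) is
-- 2 ((i + j + [p ∧ q]) mod K) + [p ≠ q], so its parity is p xor q; the four redefined cells,
-- which lie on the special lines 0 and K + m, flip that parity.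
--
-- Let T be a maximal partial transversal of length K (m ≥ 1).  It leaves K rows, K columns and
-- K symbols free, and by maximality every free cell carries one of the K used symbols.  Along a
-- free row the free columns are therefore mapped bijectively onto the used symbols, so every
-- free row and every free column meets the same number O of odd used symbols.  Sorting the
-- free lines by block and by being special turns this into a small system of linear equations
-- and bounds, which has no solution because K is odd and at least 3.
--
-- Every other length K + j with 1 ≤ j ≤ K is realised explicitly: the constructed partial
-- transversals cover every line of the second blocks and use every even symbol, so the only free
-- cells lie in the block A, where the symbols are even apart from the corner a₀₀, which is dealt
-- with separately.  For m = 0 the square is [[1,0],[0,1]], which has no transversal.

open import Defs
open import Data.Nat hiding (_<ᵇ_)
open import Data.Nat.Properties
open import Data.Nat.DivMod
open import Data.Nat.Tactic.RingSolver using (solve-∀)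
open import Data.Bool using (Bool; true; false; if_then_else_; _∧_; _∨_; not; _xor_; T)
open import Data.Bool.Properties using (∧-comm; xor-comm; ∧-identityʳ; ∧-zeroʳ; ∨-identityʳ; ∨-zeroʳ; xor-identityʳ; not-involutive)
open import Data.Unit using (tt)
open import Data.Empty using (⊥; ⊥-elim)
open import Data.Product using (_×_; _,_; proj₁; proj₂; Σ)
open import Data.Product.Properties using (≡-dec)
open import Data.Sum using (_⊎_; inj₁; inj₂)
open import Data.Fin as F using (Fin; zero; suc; toℕ; fromℕ<)
import Data.Fin.Properties as FinP
open FinP using (toℕ-fromℕ<; toℕ-injective; toℕ<n)
open import Data.List using (List; []; _∷_; length; map; applyUpTo)
open import Data.List.Properties using (length-map; length-applyUpTo; map-applyUpTo)
open import Data.List.Relation.Unary.All as All using ([]; _∷_; all?)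
open import Data.List.Relation.Unary.All.Properties using (¬Any⇒All¬; ¬All⇒Any¬)
open import Data.List.Relation.Unary.Any using (here; there)
open import Data.List.Relation.Unary.AllPairs using ([]; _∷_)
open import Data.List.Relation.Unary.Unique.Propositional using (Unique)
open import Data.List.Relation.Unary.Unique.Propositional.Properties using (applyUpTo⁺₁)
open import Data.List.Membership.Propositional using (_∈_; _∉_; find)
open import Data.List.Membership.Propositional.Properties using (∈-map⁺; ∈-map⁻; ∈-applyUpTo⁺)
import Data.List.Membership.DecPropositional as DecMembership
open import Function using (_∘_)
open import Function.Definitions using (Injective)
open import Relation.Binary.PropositionalEquality
open import Relation.Nullary using (¬_; Dec; yes; no; does)
open import Relation.Nullary.Decidable using (dec-true; dec-false)

-- Counting elements of a finite type

bit : Bool → ℕ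
bit true = 1
bit false = 0

bit≤1 : ∀ b → bit b ≤ 1
bit≤1 true = s≤s z≤n
bit≤1 false = z≤n

_==ᶠ_ : ∀ {n} → Fin n → Fin n → Bool
x ==ᶠ y = does (x F.≟ y)

==ᶠ-refl : ∀ {n} (x : Fin n) → (x ==ᶠ x) ≡ true
==ᶠ-refl x = dec-true (x F.≟ x) refl

==ᶠ-≢ : ∀ {n} {x y : Fin n} → x ≢ y → (x ==ᶠ y) ≡ false
==ᶠ-≢ {x = x} {y} = dec-false (x F.≟ y)

count : ∀ {n} → (Fin n → Bool) → ℕ
count {zero} f = 0
count {suc n} f = bit (f zero) + count (f ∘ suc)

count-cong : ∀ {n} {f g : Fin n → Bool} → (∀ x → f x ≡ g x) → count f ≡ count g
count-cong {zero} e = refl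
count-cong {suc n} e = cong₂ _+_ (cong bit (e zero)) (count-cong (e ∘ suc))

count-none : ∀ {n} (f : Fin n → Bool) → (∀ x → f x ≡ false) → count f ≡ 0
count-none {zero} f e = refl
count-none {suc n} f e rewrite e zero = count-none (f ∘ suc) (e ∘ suc)

count-all : ∀ n → count {n} (λ _ → true) ≡ n
count-all zero = refl
count-all (suc n) = cong suc (count-all n)

count-mono : ∀ {n} (f g : Fin n → Bool) → (∀ x → f x ≡ true → g x ≡ true) → count f ≤ count g
count-mono {zero} f g h = z≤n
count-mono {suc n} f g h = +-mono-≤ (bit-mono (f zero) (g zero) (h zero)) (count-mono (f ∘ suc) (g ∘ suc) (h ∘ suc))
  where
  bit-mono : ∀ a b → (a ≡ true → b ≡ true) → bit a ≤ bit b
  bit-mono false b _ = z≤n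
  bit-mono true b h rewrite h refl = ≤-refl

count-witness : ∀ {n} (f : Fin n → Bool) → 0 < count f → Σ (Fin n) λ x → f x ≡ true
count-witness {suc n} f p with f zero in ef
... | true = zero , ef
... | false with count-witness (f ∘ suc) p
... | x , e = suc x , e

private
  interchange : ∀ a b c d → (a + b) + (c + d) ≡ (a + c) + (b + d)
  interchange = solve-∀

count-split : ∀ {n} (f g : Fin n → Bool) → count f ≡ count (λ x → f x ∧ g x) + count (λ x → f x ∧ not (g x))
count-split {zero} f g = refl
count-split {suc n} f g =
  trans (cong₂ _+_ (split-bit (f zero) (g zero)) (count-split (f ∘ suc) (g ∘ suc)))
        (interchange (bit (f zero ∧ g zero)) (bit (f zero ∧ not (g zero)))
                     (count (λ x → f (suc x) ∧ g (suc x))) (count (λ x → f (suc x) ∧ not (g (suc x)))))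
  where
  split-bit : ∀ a b → bit a ≡ bit (a ∧ b) + bit (a ∧ not b)
  split-bit false b = refl
  split-bit true true = refl
  split-bit true false = refl

count-complement : ∀ {n} (f : Fin n → Bool) → count f + count (not ∘ f) ≡ n
count-complement {n} f = sym (trans (sym (count-all n)) (count-split (λ _ → true) f))

count-∨ : ∀ {n} (f g : Fin n → Bool) → count (λ x → f x ∨ g x) ≤ count f + count g
count-∨ {zero} f g = z≤n
count-∨ {suc n} f g = ≤-trans (+-mono-≤ (bit-∨ (f zero) (g zero)) (count-∨ (f ∘ suc) (g ∘ suc)))
                               (≤-reflexive (interchange (bit (f zero)) (bit (g zero)) (count (f ∘ suc)) (count (g ∘ suc))))
  where
  bit-∨ : ∀ a b → bit (a ∨ b) ≤ bit a + bit b
  bit-∨ false b = ≤-refl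
  bit-∨ true b = s≤s z≤n

count-remove : ∀ {n} (f : Fin n → Bool) (x : Fin n) → f x ≡ true →
               count f ≡ suc (count (λ y → f y ∧ not (y ==ᶠ x)))
count-remove {suc n} f zero e rewrite e = cong suc (count-cong (λ y → sym (∧-identityʳ (f (suc y)))))
count-remove {suc n} f (suc x) e = begin
  bit (f zero) + count (f ∘ suc)                               ≡⟨ cong (bit (f zero) +_) (count-remove (f ∘ suc) x e) ⟩
  bit (f zero) + suc (count (λ y → f (suc y) ∧ not (y ==ᶠ x))) ≡⟨ +-suc (bit (f zero)) _ ⟩
  suc (bit (f zero) + count (λ y → f (suc y) ∧ not (y ==ᶠ x))) ≡⟨ cong (λ b → suc (bit b + count (λ y → f (suc y) ∧ not (y ==ᶠ x)))) (sym (∧-identityʳ (f zero))) ⟩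
  suc (bit (f zero ∧ true) + count (λ y → f (suc y) ∧ not (y ==ᶠ x))) ∎
  where open ≡-Reasoning

count-positive : ∀ {n} (f : Fin n → Bool) x → f x ≡ true → 1 ≤ count f
count-positive f x e = subst (1 ≤_) (sym (count-remove f x e)) (s≤s z≤n)

count-single : ∀ {n} (x : Fin n) → count (_==ᶠ x) ≡ 1
count-single x = trans (count-remove (_==ᶠ x) x (==ᶠ-refl x)) (cong suc (count-none _ contradictory))
  where
  contradictory : ∀ y → ((y ==ᶠ x) ∧ not (y ==ᶠ x)) ≡ false
  contradictory y with y ==ᶠ x
  ... | true = refl
  ... | false = refl

count-injection : ∀ {n n′} (p : Fin n → Bool) (q : Fin n′ → Bool) (g : Fin n → Fin n′) →
  (∀ x → p x ≡ true → q (g x) ≡ true) → (∀ x y → g x ≡ g y → x ≡ y) → count p ≤ count q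
count-injection {zero} p q g maps inj = z≤n
count-injection {suc n} p q g maps inj with p zero in p0
... | false = count-injection (p ∘ suc) q (g ∘ suc) (maps ∘ suc) (λ x y e → FinP.suc-injective (inj _ _ e))
... | true = subst (suc (count (p ∘ suc)) ≤_) (sym (count-remove q (g zero) (maps zero p0)))
  (s≤s (count-injection (p ∘ suc) (λ y → q y ∧ not (y ==ᶠ g zero)) (g ∘ suc) maps′ (λ x y e → FinP.suc-injective (inj _ _ e))))
  where
  maps′ : ∀ x → p (suc x) ≡ true → (q (g (suc x)) ∧ not (g (suc x) ==ᶠ g zero)) ≡ true
  maps′ x px rewrite maps (suc x) px | ==ᶠ-≢ {x = g (suc x)} (λ e → FinP.0≢1+n (sym (inj _ _ e))) = refl

count-toℕ< : ∀ {n} b → b ≤ n → count {n} (λ x → toℕ x <ᵇ b) ≡ b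
count-toℕ< {zero} zero _ = refl
count-toℕ< {suc n} zero _ = count-none {suc n} (λ x → toℕ x <ᵇ 0) (λ x → dec-false (toℕ x <? 0) λ ())
count-toℕ< {suc n} (suc b) (s≤s b≤n) = cong suc (count-toℕ< {n} b b≤n)

_∈ᵇ_ : ∀ {n} → Fin n → List (Fin n) → Bool
y ∈ᵇ [] = false
y ∈ᵇ (x ∷ xs) = (y ==ᶠ x) ∨ (y ∈ᵇ xs)

∈⇒∈ᵇ : ∀ {n} {y : Fin n} {xs} → y ∈ xs → (y ∈ᵇ xs) ≡ true
∈⇒∈ᵇ {y = y} (here refl) rewrite ==ᶠ-refl y = refl
∈⇒∈ᵇ {y = y} (there p) rewrite ∈⇒∈ᵇ p = ∨-zeroʳ (y ==ᶠ _)

Unique⇒length≤count : ∀ {n} (xs : List (Fin n)) (q : Fin n → Bool) → Unique xs →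
  (∀ {x} → x ∈ xs → q x ≡ true) → length xs ≤ count q
Unique⇒length≤count [] q u h = z≤n
Unique⇒length≤count (x ∷ xs) q (x∉xs ∷ u) h = subst (suc (length xs) ≤_) (sym (count-remove q x (h (here refl))))
  (s≤s (Unique⇒length≤count xs _ u h′))
  where
  h′ : ∀ {y} → y ∈ xs → (q y ∧ not (y ==ᶠ x)) ≡ true
  h′ {y} y∈xs rewrite h (there y∈xs) | ==ᶠ-≢ {x = y} (λ e → All.lookup x∉xs y∈xs (sym e)) = refl

count-∈ᵇ≤length : ∀ {n} (xs : List (Fin n)) → count (_∈ᵇ xs) ≤ length xs
count-∈ᵇ≤length {n} [] = ≤-reflexive (count-none {n} (λ _ → false) (λ _ → refl))
count-∈ᵇ≤length (x ∷ xs) = ≤-trans (count-∨ (_==ᶠ x) (_∈ᵇ xs))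
  (subst (λ c → c + count (_∈ᵇ xs) ≤ suc (length xs)) (sym (count-single x)) (s≤s (count-∈ᵇ≤length xs)))

count-∈ᵇ : ∀ {n} (xs : List (Fin n)) → Unique xs → count (_∈ᵇ xs) ≡ length xs
count-∈ᵇ xs u = ≤-antisym (count-∈ᵇ≤length xs) (Unique⇒length≤count xs _ u ∈⇒∈ᵇ)

Unique-⊆⇒length≤ : ∀ {n} (xs ys : List (Fin n)) → Unique xs → (∀ {x} → x ∈ xs → x ∈ ys) → length xs ≤ length ys
Unique-⊆⇒length≤ xs ys u h = ≤-trans (Unique⇒length≤count xs (_∈ᵇ ys) u (∈⇒∈ᵇ ∘ h)) (count-∈ᵇ≤length ys)

-- Boolean tests and modular arithmetic

true≢false : true ≢ false
true≢false ()

if-true : ∀ {A : Set} {b} {x y : A} → b ≡ true → (if b then x else y) ≡ x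
if-true refl = refl

if-false : ∀ {A : Set} {b} {x y : A} → b ≡ false → (if b then x else y) ≡ y
if-false refl = refl

==⇒≡ : ∀ {a b} → (a == b) ≡ true → a ≡ b
==⇒≡ {a} {b} e = ≡ᵇ⇒≡ a b (subst T (sym e) tt)

==-refl : ∀ a → (a == a) ≡ true
==-refl a = dec-true (a ≟ a) refl

==-≢ : ∀ {a b} → a ≢ b → (a == b) ≡ false
==-≢ {a} {b} = dec-false (a ≟ b)

==-cancelˡ : ∀ a x y → ((a + x) == (a + y)) ≡ (x == y)
==-cancelˡ a x y with x ≟ y
... | yes refl = trans (==-refl (a + x)) (sym (==-refl x))
... | no x≢y = trans (==-≢ (x≢y ∘ +-cancelˡ-≡ a x y)) (sym (==-≢ x≢y))

<ᵇ-true : ∀ {a b} → a < b → (a <ᵇ b) ≡ true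
<ᵇ-true {a} {b} = dec-true (a <? b)

<ᵇ-false : ∀ {a b} → b ≤ a → (a <ᵇ b) ≡ false
<ᵇ-false {a} {b} b≤a = dec-false (a <? b) (≤⇒≯ b≤a)

∧≡true : ∀ {x y} → (x ∧ y) ≡ true → x ≡ true × y ≡ true
∧≡true {true} {true} _ = refl , refl

[m%d+n]%d≡[m+n]%d : ∀ m n d .{{_ : NonZero d}} → (m % d + n) % d ≡ (m + n) % d
[m%d+n]%d≡[m+n]%d m n d = begin
  (m % d + n) % d         ≡⟨ %-distribˡ-+ (m % d) n d ⟩
  (m % d % d + n % d) % d ≡⟨ cong (λ x → (x + n % d) % d) (m%n%n≡m%n m d) ⟩
  (m % d + n % d) % d     ≡⟨ %-distribˡ-+ m n d ⟨
  (m + n) % d             ∎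
  where open ≡-Reasoning

[m+n%d]%d≡[m+n]%d : ∀ m n d .{{_ : NonZero d}} → (m + n % d) % d ≡ (m + n) % d
[m+n%d]%d≡[m+n]%d m n d = begin
  (m + n % d) % d ≡⟨ cong (_% d) (+-comm m (n % d)) ⟩
  (n % d + m) % d ≡⟨ [m%d+n]%d≡[m+n]%d n m d ⟩
  (n + m) % d     ≡⟨ cong (_% d) (+-comm n m) ⟩
  (m + n) % d     ∎
  where open ≡-Reasoning

[c*[m%d]+n]%d≡[c*m+n]%d : ∀ c m n d .{{_ : NonZero d}} → (c * (m % d) + n) % d ≡ (c * m + n) % d
[c*[m%d]+n]%d≡[c*m+n]%d c m n d = sym (begin
  (c * m + n) % d                               ≡⟨ cong (λ x → (c * x + n) % d) (m≡m%n+[m/n]*n m d) ⟩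
  (c * (m % d + m / d * d) + n) % d             ≡⟨ cong (_% d) (regroup c (m % d) (m / d) d n) ⟩
  (c * (m % d) + n + c * (m / d) * d) % d       ≡⟨ [m+kn]%n≡m%n (c * (m % d) + n) (c * (m / d)) d ⟩
  (c * (m % d) + n) % d                         ∎)
  where
  open ≡-Reasoning
  regroup : ∀ c r q d n → c * (r + q * d) + n ≡ c * r + n + c * q * d
  regroup = solve-∀

-- Adding d ∸ (a % d) on the left undoes a translation by a modulo d.
+-cancelˡ-% : ∀ a x y d .{{_ : NonZero d}} → (a + x) % d ≡ (a + y) % d → x % d ≡ y % d
+-cancelˡ-% a x y d e = begin
  x % d                           ≡⟨ untranslate x ⟨
  (a⁻ + (a + x)) % d              ≡⟨ [m+n%d]%d≡[m+n]%d a⁻ (a + x) d ⟨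
  (a⁻ + (a + x) % d) % d          ≡⟨ cong (λ z → (a⁻ + z) % d) e ⟩
  (a⁻ + (a + y) % d) % d          ≡⟨ [m+n%d]%d≡[m+n]%d a⁻ (a + y) d ⟩
  (a⁻ + (a + y)) % d              ≡⟨ untranslate y ⟩
  y % d                           ∎
  where
  open ≡-Reasoning
  a⁻ : ℕ
  a⁻ = d ∸ a % d
  regroup : ∀ p q r s → p + ((q + r) + s) ≡ (p + q) + r + s
  regroup = solve-∀
  untranslate : ∀ z → (a⁻ + (a + z)) % d ≡ z % d
  untranslate z = begin
    (a⁻ + (a + z)) % d                     ≡⟨ cong (λ b → (a⁻ + (b + z)) % d) (m≡m%n+[m/n]*n a d) ⟩
    (a⁻ + ((a % d + a / d * d) + z)) % d   ≡⟨ cong (_% d) (regroup a⁻ (a % d) (a / d * d) z) ⟩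
    ((a⁻ + a % d) + a / d * d + z) % d     ≡⟨ cong (λ b → (b + a / d * d + z) % d) (m∸n+n≡m (m%n≤n a d)) ⟩
    (d + a / d * d + z) % d                ≡⟨ cong (_% d) (+-comm (d + a / d * d) z) ⟩
    (z + (1 + a / d) * d) % d              ≡⟨ [m+kn]%n≡m%n z (1 + a / d) d ⟩
    z % d                                  ∎

+-cancelˡ-%-< : ∀ a x y d .{{_ : NonZero d}} → (a + x) % d ≡ (a + y) % d → x < d → y < d → x ≡ y
+-cancelˡ-%-< a x y d e x<d y<d =
  trans (sym (m<n⇒m%n≡m x<d)) (trans (+-cancelˡ-% a x y d e) (m<n⇒m%n≡m y<d))

[2h+e]%2≡e : ∀ h e → e ≤ 1 → (2 * h + e) % 2 ≡ e
[2h+e]%2≡e h e e≤1 = trans (cong (_% 2) (regroup h e)) (trans ([m+kn]%n≡m%n e h 2) (m<n⇒m%n≡m (s≤s e≤1)))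
  where
  regroup : ∀ h e → 2 * h + e ≡ e + h * 2
  regroup = solve-∀

[2h+e]/2≡h : ∀ h e → e ≤ 1 → (2 * h + e) / 2 ≡ h
[2h+e]/2≡h h e e≤1 = *-cancelˡ-≡ _ _ 2 (+-cancelʳ-≡ e _ _ (begin
  2 * ((2 * h + e) / 2) + e                     ≡⟨ cong (2 * ((2 * h + e) / 2) +_) ([2h+e]%2≡e h e e≤1) ⟨
  2 * ((2 * h + e) / 2) + (2 * h + e) % 2       ≡⟨ swap ((2 * h + e) / 2) ((2 * h + e) % 2) ⟩
  (2 * h + e) % 2 + ((2 * h + e) / 2) * 2       ≡⟨ m≡m%n+[m/n]*n (2 * h + e) 2 ⟨
  2 * h + e                                     ∎))
  where
  open ≡-Reasoning
  swap : ∀ q r → 2 * q + r ≡ r + q * 2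
  swap = solve-∀

2h+e-injective : ∀ h h′ e e′ → e ≤ 1 → e′ ≤ 1 → 2 * h + e ≡ 2 * h′ + e′ → h ≡ h′ × e ≡ e′
2h+e-injective h h′ e e′ e≤1 e′≤1 eq = h≡h′ , e≡e′
  where
  e≡e′ : e ≡ e′
  e≡e′ = trans (sym ([2h+e]%2≡e h e e≤1)) (trans (cong (_% 2) eq) ([2h+e]%2≡e h′ e′ e′≤1))
  h≡h′ : h ≡ h′
  h≡h′ = *-cancelˡ-≡ h h′ 2 (+-cancelʳ-≡ e (2 * h) (2 * h′) (trans eq (cong (2 * h′ +_) (sym e≡e′))))

-- The block structure of M*

K : ℕ → ℕ
K m = 1 + 2 * m

K≡2m+1 : ∀ m → K m ≡ 2 * m + 1
K≡2m+1 m = +-comm 1 (2 * m)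

ord≡K+K : ∀ m → ord m ≡ K m + K m
ord≡K+K = unfolded
  where
  unfolded : ∀ m → 2 + 4 * m ≡ (1 + 2 * m) + (1 + 2 * m)
  unfolded = solve-∀

ord≡K*2 : ∀ m → ord m ≡ K m * 2
ord≡K*2 = unfolded
  where
  unfolded : ∀ m → 2 + 4 * m ≡ (1 + 2 * m) * 2
  unfolded = solve-∀

m<K : ∀ m → m < K m
m<K m = s≤s (m≤m+n m (m + 0))

K<ord : ∀ m → K m < ord m
K<ord m = subst (K m <_) (sym (ord≡K+K m)) (m<m+n (K m) (s≤s z≤n))

3≤K : ∀ m → 1 ≤ m → 3 ≤ K m
3≤K (suc m) _ = s≤s (s≤s (≤-trans (s≤s z≤n) (m≤n+m _ m)))

K≢x+x : ∀ m x → K m ≢ x + x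
K≢x+x zero zero ()
K≢x+x zero (suc x) e = 0≢1+n (trans (suc-injective e) (+-suc x x))
K≢x+x (suc m) zero ()
K≢x+x (suc m) (suc x) e = K≢x+x m x (suc-injective (suc-injective (trans (sym (unfold m)) (trans e (cong suc (+-suc x x))))))
  where
  unfold : ∀ m → 1 + 2 * suc m ≡ 2 + (1 + 2 * m)
  unfold = solve-∀

[2x]%ord≡2[x%K] : ∀ m x → (2 * x) % ord m ≡ 2 * (x % K m)
[2x]%ord≡2[x%K] m x = begin
  (2 * x) % ord m     ≡⟨ cong (_% ord m) (*-comm 2 x) ⟩
  (x * 2) % ord m     ≡⟨ %-congʳ {o = x * 2} (ord≡K*2 m) ⟩
  (x * 2) % (K m * 2) ≡⟨ m%n*o≡m*o%[n*o] x (K m) 2 ⟨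
  (x % K m) * 2       ≡⟨ *-comm (x % K m) 2 ⟩
  2 * (x % K m)       ∎
  where open ≡-Reasoning

[2x+1]%ord≡2[x%K]+1 : ∀ m x → (2 * x + 1) % ord m ≡ 2 * (x % K m) + 1
[2x+1]%ord≡2[x%K]+1 m x = begin
  (2 * x + 1) % ord m     ≡⟨ cong (λ z → (z + 1) % ord m) (*-comm 2 x) ⟩
  (x * 2 + 1) % ord m     ≡⟨ %-congʳ {o = x * 2 + 1} (ord≡K*2 m) ⟩
  (x * 2 + 1) % (K m * 2) ≡⟨ [m*n+o]%[p*n]≡[m*n]%[p*n]+o x (K m) (s≤s (s≤s z≤n)) ⟩
  (x * 2) % (K m * 2) + 1 ≡⟨ cong (_+ 1) (m%n*o≡m*o%[n*o] x (K m) 2) ⟨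
  (x % K m) * 2 + 1       ≡⟨ cong (_+ 1) (*-comm (x % K m) 2) ⟩
  2 * (x % K m) + 1       ∎
  where open ≡-Reasoning

-- A line (row or column) is addressed by its block p (false for the first K m lines) and its
-- index i < K m inside the block.  The redefined cells a₀₀, b₀ₘ, cₘ₀, dₘₘ are exactly those
-- whose two local indices are the special indices of their blocks.
blockIndex : ℕ → Bool → ℕ → ℕ
blockIndex m false i = i
blockIndex m true i = K m + i

specialIndex : ℕ → Bool → ℕ
specialIndex m false = 0
specialIndex m true = m

isSpecialCell : ℕ → Bool → ℕ → Bool → ℕ → Bool
isSpecialCell m p i q j = (i == specialIndex m p) ∧ (j == specialIndex m q)

specialSymbol : ℕ → Bool → Bool → ℕ
specialSymbol m p q = if p xor q then 0 else K m

regularSymbol : ℕ → Bool → ℕ → Bool → ℕ → ℕ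
regularSymbol m p i q j = 2 * ((i + bit (p ∧ q) + j) % K m) + bit (p xor q)

blockSymbol : ℕ → Bool → ℕ → Bool → ℕ → ℕ
blockSymbol m p i q j = if isSpecialCell m p i q j then specialSymbol m p q else regularSymbol m p i q j

blockSymbol-special : ∀ m p i q j → isSpecialCell m p i q j ≡ true → blockSymbol m p i q j ≡ specialSymbol m p q
blockSymbol-special m p i q j = if-true

blockSymbol-regular : ∀ m p i q j → isSpecialCell m p i q j ≡ false → blockSymbol m p i q j ≡ regularSymbol m p i q j
blockSymbol-regular m p i q j = if-false

isSpecialCell⇒ : ∀ m p i q j → isSpecialCell m p i q j ≡ true → i ≡ specialIndex m p × j ≡ specialIndex m q
isSpecialCell⇒ m p i q j e with ∧≡true {i == specialIndex m p} e
... | i-special , j-special = ==⇒≡ i-special , ==⇒≡ j-special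

isSpecialCell⇐ : ∀ m p q → isSpecialCell m p (specialIndex m p) q (specialIndex m q) ≡ true
isSpecialCell⇐ m p q rewrite ==-refl (specialIndex m p) | ==-refl (specialIndex m q) = refl

entryℕ%ord≡blockSymbol : ∀ m p i q j → i < K m → j < K m →
  entryℕ m (blockIndex m p i) (blockIndex m q j) % ord m ≡ blockSymbol m p i q j
entryℕ%ord≡blockSymbol m false i false j i<K j<K
  rewrite <ᵇ-true i<K | <ᵇ-true j<K with (i == 0) ∧ (j == 0)
... | true = m<n⇒m%n≡m (K<ord m)
... | false = trans ([2x]%ord≡2[x%K] m (i + j))
                    (trans (cong (λ z → 2 * ((z + j) % K m)) (sym (+-identityʳ i))) (sym (+-identityʳ _)))
entryℕ%ord≡blockSymbol m false i true j i<K j<K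
  rewrite <ᵇ-true i<K | <ᵇ-false (m≤m+n (K m) j) | m+n∸m≡n (K m) j with (i == 0) ∧ (j == m)
... | true = refl
... | false = trans ([2x+1]%ord≡2[x%K]+1 m (i + j)) (cong (λ z → 2 * ((z + j) % K m) + 1) (sym (+-identityʳ i)))
entryℕ%ord≡blockSymbol m true i false j i<K j<K
  rewrite <ᵇ-false (m≤m+n (K m) i) | <ᵇ-true j<K | m+n∸m≡n (K m) i with (i == m) ∧ (j == 0)
... | true = refl
... | false = trans ([2x+1]%ord≡2[x%K]+1 m (i + j)) (cong (λ z → 2 * ((z + j) % K m) + 1) (sym (+-identityʳ i)))
entryℕ%ord≡blockSymbol m true i true j i<K j<K
  rewrite <ᵇ-false (m≤m+n (K m) i) | <ᵇ-false (m≤m+n (K m) j) | m+n∸m≡n (K m) i | m+n∸m≡n (K m) j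
  with (i == m) ∧ (j == m)
... | true = m<n⇒m%n≡m (K<ord m)
... | false = trans (cong (_% ord m) (regroup i j)) (trans ([2x]%ord≡2[x%K] m (i + 1 + j)) (sym (+-identityʳ _)))
  where
  regroup : ∀ i j → 2 * (i + j) + 2 ≡ 2 * (i + 1 + j)
  regroup = solve-∀

Mstar≡blockSymbol : ∀ m (r c : Fin (ord m)) p i q j → i < K m → j < K m →
  toℕ r ≡ blockIndex m p i → toℕ c ≡ blockIndex m q j → toℕ (Mstar m r c) ≡ blockSymbol m p i q j
Mstar≡blockSymbol m r c p i q j i<K j<K r≡ c≡ =
  trans (toℕ-fromℕ< _) (trans (cong₂ (λ a b → entryℕ m a b % ord m) r≡ c≡) (entryℕ%ord≡blockSymbol m p i q j i<K j<K))

BlockCoordinates : ℕ → ℕ → Set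
BlockCoordinates m x = Σ Bool λ p → Σ ℕ λ i → i < K m × x ≡ blockIndex m p i

blockCoordinates : ∀ m (x : Fin (ord m)) → BlockCoordinates m (toℕ x)
blockCoordinates m x with toℕ x <? K m
... | yes x<K = false , toℕ x , x<K , refl
... | no x≮K = true , toℕ x ∸ K m , x∸K<K , sym (m+[n∸m]≡n (≮⇒≥ x≮K))
  where
  x∸K<K : toℕ x ∸ K m < K m
  x∸K<K = m<n+o⇒m∸n<o (toℕ x) (K m) (subst (toℕ x <_) (ord≡K+K m) (toℕ<n x))

blockIndex<ord : ∀ m p i → i < K m → blockIndex m p i < ord m
blockIndex<ord m false i i<K = <-trans i<K (K<ord m)
blockIndex<ord m true i i<K = subst (K m + i <_) (sym (ord≡K+K m)) (+-monoʳ-< (K m) i<K)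

blockIndex-injective : ∀ m p i p′ i′ → i < K m → i′ < K m → blockIndex m p i ≡ blockIndex m p′ i′ → p ≡ p′ × i ≡ i′
blockIndex-injective m false i false i′ _ _ e = refl , e
blockIndex-injective m true i true i′ _ _ e = refl , +-cancelˡ-≡ (K m) i i′ e
blockIndex-injective m false i true i′ i<K _ e = ⊥-elim (<⇒≢ (<-≤-trans i<K (m≤m+n (K m) i′)) e)
blockIndex-injective m true i false i′ _ i′<K e = ⊥-elim (<⇒≢ (<-≤-trans i′<K (m≤m+n (K m) i)) (sym e))

private
  i+b+j≡j+b+i : ∀ i b j → i + b + j ≡ j + b + i
  i+b+j≡j+b+i = solve-∀

blockSymbol-comm : ∀ m p i q j → blockSymbol m p i q j ≡ blockSymbol m q j p i
blockSymbol-comm m p i q j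
  rewrite ∧-comm (i == specialIndex m p) (j == specialIndex m q) | xor-comm p q | ∧-comm p q
        | i+b+j≡j+b+i i (bit (q ∧ p)) j = refl

Mstar-symmetric : ∀ m r c → Mstar m r c ≡ Mstar m c r
Mstar-symmetric m r c with blockCoordinates m r | blockCoordinates m c
... | p , i , i<K , r≡ | q , j , j<K , c≡ = toℕ-injective (begin
  toℕ (Mstar m r c)     ≡⟨ Mstar≡blockSymbol m r c p i q j i<K j<K r≡ c≡ ⟩
  blockSymbol m p i q j ≡⟨ blockSymbol-comm m p i q j ⟩
  blockSymbol m q j p i ≡⟨ Mstar≡blockSymbol m c r q j p i j<K i<K c≡ r≡ ⟨
  toℕ (Mstar m c r)     ∎)
  where open ≡-Reasoning

bit-xor-injective : ∀ p q q′ → bit (p xor q) ≡ bit (p xor q′) → q ≡ q′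
bit-xor-injective false false false _ = refl
bit-xor-injective false true true _ = refl
bit-xor-injective true false false _ = refl
bit-xor-injective true true true _ = refl

regularSymbol-injectiveʳ : ∀ m p i q j q′ j′ → j < K m → j′ < K m →
  regularSymbol m p i q j ≡ regularSymbol m p i q′ j′ → q ≡ q′ × j ≡ j′
regularSymbol-injectiveʳ m p i q j q′ j′ j<K j′<K e
  with 2h+e-injective ((i + bit (p ∧ q) + j) % K m) ((i + bit (p ∧ q′) + j′) % K m) (bit (p xor q)) (bit (p xor q′)) (bit≤1 (p xor q)) (bit≤1 (p xor q′)) e
... | halves , parities with bit-xor-injective p q q′ parities
... | refl = refl , +-cancelˡ-%-< (i + bit (p ∧ q)) j j′ (K m) halves j<K j′<K

specialSymbol-injective : ∀ m p q q′ → specialSymbol m p q ≡ specialSymbol m p q′ → q ≡ q′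
specialSymbol-injective m false false false e = refl
specialSymbol-injective m false true true e = refl
specialSymbol-injective m true false false e = refl
specialSymbol-injective m true true true e = refl

-- Parity forces q′ = not q; halving then puts the regular cell on the special line of block q′.
specialSymbol≢regularSymbol : ∀ m p q q′ j′ → j′ < K m → isSpecialCell m p (specialIndex m p) q′ j′ ≡ false →
  specialSymbol m p q ≢ regularSymbol m p (specialIndex m p) q′ j′
specialSymbol≢regularSymbol m false false q′ j′ j′<K regular e
  with 2h+e-injective m ((0 + 0 + j′) % K m) 1 (bit q′) (s≤s z≤n) (bit≤1 q′) (trans (sym (K≡2m+1 m)) e)
specialSymbol≢regularSymbol m false false true j′ j′<K regular e | halves , _ =
  true≢false (trans (sym (special (sym (trans halves (m<n⇒m%n≡m j′<K))))) regular)
  where special : j′ ≡ m → isSpecialCell m false 0 true j′ ≡ true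
        special refl = isSpecialCell⇐ m false true
specialSymbol≢regularSymbol m false true q′ j′ j′<K regular e
  with 2h+e-injective 0 ((0 + 0 + j′) % K m) 0 (bit q′) z≤n (bit≤1 q′) e
specialSymbol≢regularSymbol m false true false j′ j′<K regular e | halves , _ =
  true≢false (trans (sym (special (sym (trans halves (m<n⇒m%n≡m j′<K))))) regular)
  where special : j′ ≡ 0 → isSpecialCell m false 0 false j′ ≡ true
        special refl = isSpecialCell⇐ m false false
specialSymbol≢regularSymbol m true false q′ j′ j′<K regular e
  with 2h+e-injective 0 ((m + bit q′ + j′) % K m) 0 (bit (not q′)) z≤n (bit≤1 (not q′)) e
specialSymbol≢regularSymbol m true false true j′ j′<K regular e | halves , _ =
  true≢false (trans (sym (special j′≡m)) regular)
  where
  m+1+m≡K : ∀ m → m + 1 + m ≡ 1 + 2 * m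
  m+1+m≡K = solve-∀
  j′≡m : j′ ≡ m
  j′≡m = +-cancelˡ-%-< (m + 1) j′ m (K m)
           (trans (sym halves) (sym (trans (cong (_% K m) (m+1+m≡K m)) (n%n≡0 (K m))))) j′<K (m<K m)
  special : j′ ≡ m → isSpecialCell m true m true j′ ≡ true
  special refl = isSpecialCell⇐ m true true
specialSymbol≢regularSymbol m true true q′ j′ j′<K regular e
  with 2h+e-injective m ((m + bit q′ + j′) % K m) 1 (bit (not q′)) (s≤s z≤n) (bit≤1 (not q′)) (trans (sym (K≡2m+1 m)) e)
specialSymbol≢regularSymbol m true true false j′ j′<K regular e | halves , _ =
  true≢false (trans (sym (special j′≡0)) regular)
  where
  m+0+0≡m : m + 0 + 0 ≡ m
  m+0+0≡m = trans (+-identityʳ (m + 0)) (+-identityʳ m)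
  j′≡0 : j′ ≡ 0
  j′≡0 = +-cancelˡ-%-< (m + 0) j′ 0 (K m)
           (trans (sym halves) (sym (trans (cong (_% K m) m+0+0≡m) (m<n⇒m%n≡m (m<K m))))) j′<K (s≤s z≤n)
  special : j′ ≡ 0 → isSpecialCell m true m false j′ ≡ true
  special refl = isSpecialCell⇐ m true false

blockSymbol-injectiveʳ : ∀ m p i q j q′ j′ → j < K m → j′ < K m →
  blockSymbol m p i q j ≡ blockSymbol m p i q′ j′ → q ≡ q′ × j ≡ j′
blockSymbol-injectiveʳ m p i q j q′ j′ j<K j′<K e
  with isSpecialCell m p i q j in s | isSpecialCell m p i q′ j′ in s′
... | true | true with specialSymbol-injective m p q q′ e
... | refl = refl , trans (proj₂ (isSpecialCell⇒ m p i q j s)) (sym (proj₂ (isSpecialCell⇒ m p i q j′ s′)))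
blockSymbol-injectiveʳ m p i q j q′ j′ j<K j′<K e | false | false = regularSymbol-injectiveʳ m p i q j q′ j′ j<K j′<K e
blockSymbol-injectiveʳ m p i q j q′ j′ j<K j′<K e | true | false with isSpecialCell⇒ m p i q j s
... | refl , _ = ⊥-elim (specialSymbol≢regularSymbol m p q q′ j′ j′<K s′ e)
blockSymbol-injectiveʳ m p i q j q′ j′ j<K j′<K e | false | true with isSpecialCell⇒ m p i q′ j′ s′
... | refl , _ = ⊥-elim (specialSymbol≢regularSymbol m p q′ q j j<K s (sym e))

Mstar-row-injective : ∀ m r → Injective _≡_ _≡_ (Mstar m r)
Mstar-row-injective m r {c} {c′} e with blockCoordinates m r | blockCoordinates m c | blockCoordinates m c′
... | p , i , i<K , r≡ | q , j , j<K , c≡ | q′ , j′ , j′<K , c′≡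
  with blockSymbol-injectiveʳ m p i q j q′ j′ j<K j′<K
         (trans (sym (Mstar≡blockSymbol m r c p i q j i<K j<K r≡ c≡))
                (trans (cong toℕ e) (Mstar≡blockSymbol m r c′ p i q′ j′ i<K j′<K r≡ c′≡)))
... | refl , refl = toℕ-injective (trans c≡ (sym c′≡))

Mstar-latin : ∀ m → IsLatin (Mstar m)
Mstar-latin m = Mstar-row-injective m , λ c {r} {r′} e →
  Mstar-row-injective m c (trans (Mstar-symmetric m c r) (trans e (Mstar-symmetric m r′ c)))

-- Maximality of partial transversals

Unique-map⇒injective : ∀ {A B : Set} (f : A → B) {xs : List A} → Unique (map f xs) →
  ∀ {a b} → a ∈ xs → b ∈ xs → f a ≡ f b → a ≡ b
Unique-map⇒injective f (_ ∷ _) (here refl) (here refl) e = refl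
Unique-map⇒injective f (fx∉ ∷ _) (here refl) (there b∈) e = ⊥-elim (All.lookup fx∉ (∈-map⁺ f b∈) e)
Unique-map⇒injective f (fx∉ ∷ _) (there a∈) (here refl) e = ⊥-elim (All.lookup fx∉ (∈-map⁺ f a∈) (sym e))
Unique-map⇒injective f (_ ∷ u) (there a∈) (there b∈) e = Unique-map⇒injective f u a∈ b∈ e

module _ {n : ℕ} (L : Square n) where

  Blocked : List (Cell n) → Set
  Blocked T = ∀ r c → r ∉ map proj₁ T → c ∉ map proj₂ T → L r c ∈ map (symbolOf L) T

  private
    _≟ᶜ_ : (x y : Cell n) → Dec (x ≡ y)
    _≟ᶜ_ = ≡-dec F._≟_ F._≟_
    open DecMembership _≟ᶜ_ using () renaming (_∈?_ to _∈ᶜ?_)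
    open DecMembership (F._≟_ {n}) using () renaming (_∈?_ to _∈ᶠ?_)

  -- A cell of a longer partial transversal that is not in T has a free row and a free column,
  -- so by blocking its symbol is already used by T.
  blocked⇒maximal : ∀ T → IsPartialTransversal L T → Blocked T → IsMaximalPT L T
  blocked⇒maximal T pt blocked = pt , λ (T′ , (rows′ , cols′ , syms′) , T⊆T′ , longer) → refute T′ rows′ cols′ syms′ T⊆T′ longer
    where
    refute : ∀ T′ → Unique (map proj₁ T′) → Unique (map proj₂ T′) → Unique (map (symbolOf L) T′) →
             T ⊆ T′ → length T < length T′ → ⊥
    refute T′ rows′ cols′ syms′ T⊆T′ longer with all? (_∈ᶜ? T) T′
    ... | yes T′⊆T = <⇒≱ longer (subst₂ _≤_ (length-map proj₁ T′) (length-map proj₁ T)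
                       (Unique-⊆⇒length≤ (map proj₁ T′) (map proj₁ T) rows′ rows⊆))
      where
      rows⊆ : ∀ {r} → r ∈ map proj₁ T′ → r ∈ map proj₁ T
      rows⊆ r∈ with ∈-map⁻ proj₁ r∈
      ... | x , x∈T′ , refl = ∈-map⁺ proj₁ (All.lookup T′⊆T x∈T′)
    ... | no T′⊈T with find (¬All⇒Any¬ (_∈ᶜ? T) T′ T′⊈T)
    ... | x , x∈T′ , x∉T = x∉T (sharing (symbolOf L) syms′ (blocked (proj₁ x) (proj₂ x) (free proj₁ rows′) (free proj₂ cols′)))
      where
      sharing : (f : Cell n → Fin n) → Unique (map f T′) → f x ∈ map f T → x ∈ T
      sharing f u fx∈ with ∈-map⁻ f fx∈
      ... | y , y∈T , e = subst (_∈ T) (sym (Unique-map⇒injective f u x∈T′ (T⊆T′ y∈T) e)) y∈T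
      free : (f : Cell n → Fin n) → Unique (map f T′) → f x ∉ map f T
      free f u = x∉T ∘ sharing f u

  maximal⇒blocked : ∀ T → IsMaximalPT L T → Blocked T
  maximal⇒blocked T ((rows , cols , syms) , unextendable) r c r∉ c∉ with L r c ∈ᶠ? map (symbolOf L) T
  ... | yes s∈ = s∈
  ... | no s∉ = ⊥-elim (unextendable ((r , c) ∷ T ,
          (¬Any⇒All¬ _ r∉ ∷ rows , ¬Any⇒All¬ _ c∉ ∷ cols , ¬Any⇒All¬ _ s∉ ∷ syms) , there , ≤-refl))

-- Block designs

finOrd : ∀ m → ℕ → Fin (ord m)
finOrd m x = fromℕ< (m%n<n x (ord m))

toℕ-finOrd : ∀ m x → x < ord m → toℕ (finOrd m x) ≡ x
toℕ-finOrd m x x<ord = trans (toℕ-fromℕ< _) (m<n⇒m%n≡m x<ord)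

-- Modulo K m = 2m + 1, multiplication by 1 + m inverts doubling and adding 2m subtracts 1.
oddPreimage : ℕ → ℕ → ℕ
oddPreimage m h = ((h + 2 * m) * (1 + m)) % K m

oddPreimage<K : ∀ m h → oddPreimage m h < K m
oddPreimage<K m h = m%n<n ((h + 2 * m) * (1 + m)) (K m)

2*oddPreimage+1 : ∀ m h → (2 * oddPreimage m h + 1) % K m ≡ h % K m
2*oddPreimage+1 m h = begin
  (2 * (((h + 2 * m) * (1 + m)) % K m) + 1) % K m ≡⟨ [c*[m%d]+n]%d≡[c*m+n]%d 2 ((h + 2 * m) * (1 + m)) 1 (K m) ⟩
  (2 * ((h + 2 * m) * (1 + m)) + 1) % K m         ≡⟨ cong (_% K m) (regroup h m) ⟩
  (h + (h + 2 * m + 1) * K m) % K m               ≡⟨ [m+kn]%n≡m%n h (h + 2 * m + 1) (K m) ⟩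
  h % K m                                         ∎
  where
  open ≡-Reasoning
  regroup : ∀ h m → 2 * ((h + 2 * m) * (1 + m)) + 1 ≡ h + (h + 2 * m + 1) * (1 + 2 * m)
  regroup = solve-∀

oddPreimage-2x+1 : ∀ m x → x < K m → oddPreimage m ((2 * x + 1) % K m) ≡ x
oddPreimage-2x+1 m x x<K = begin
  (((2 * x + 1) % K m + 2 * m) * (1 + m)) % K m ≡⟨ cong (_% K m) (regroup₁ ((2 * x + 1) % K m) m) ⟩
  ((1 + m) * ((2 * x + 1) % K m) + 2 * m * (1 + m)) % K m
    ≡⟨ [c*[m%d]+n]%d≡[c*m+n]%d (1 + m) (2 * x + 1) (2 * m * (1 + m)) (K m) ⟩
  ((1 + m) * (2 * x + 1) + 2 * m * (1 + m)) % K m ≡⟨ cong (_% K m) (regroup₂ x m) ⟩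
  (x + (x + 1 + m) * K m) % K m                   ≡⟨ [m+kn]%n≡m%n x (x + 1 + m) (K m) ⟩
  x % K m                                         ≡⟨ m<n⇒m%n≡m x<K ⟩
  x                                               ∎
  where
  open ≡-Reasoning
  regroup₁ : ∀ y m → (y + 2 * m) * (1 + m) ≡ (1 + m) * y + 2 * m * (1 + m)
  regroup₁ = solve-∀
  regroup₂ : ∀ x m → (1 + m) * (2 * x + 1) + 2 * m * (1 + m) ≡ x + (x + 1 + m) * (1 + 2 * m)
  regroup₂ = solve-∀

evenSymbol : ℕ → ℕ → ℕ
evenSymbol m x = 2 * ((2 * x + 1) % K m) + 0

record BlockCell : Set where
  constructor ⟨_,_∣_,_⟩
  field
    rowBlock : Bool
    rowIndex : ℕ
    colBlock : Bool
    colIndex : ℕ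

open BlockCell

symbolAt : ℕ → BlockCell → ℕ
symbolAt m c = blockSymbol m (rowBlock c) (rowIndex c) (colBlock c) (colIndex c)

record LabelledCell (m : ℕ) (rowLabel colLabel : Bool → ℕ → ℕ) (symbolLabel : ℕ → ℕ) (t : ℕ) (c : BlockCell) : Set where
  field
    rowIndex<K : rowIndex c < K m
    colIndex<K : colIndex c < K m
    rowLabel≡ : rowLabel (rowBlock c) (rowIndex c) ≡ t
    colLabel≡ : colLabel (colBlock c) (colIndex c) ≡ t
    symbolLabel≡ : symbolLabel (symbolAt m c) ≡ t

-- ℓ cells of M* m whose rows, columns and symbols are pairwise distinct (witnessed by left
-- inverses) and which cover every line of the second blocks.  The only free cells then lie in
-- the block A, and they are blocked: the cells t < K m carry all K m even symbols, and the
-- corner a₀₀, the only odd cell of A, has its symbol K m used or its column covered.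
record BlockDesign (m ℓ : ℕ) : Set where
  field
    cell : ℕ → BlockCell
    rowLabel colLabel : Bool → ℕ → ℕ
    symbolLabel : ℕ → ℕ
    labelled : ∀ t → t < ℓ → LabelledCell m rowLabel colLabel symbolLabel t (cell t)
    lowerRows-covered : ∀ i → i < K m → Σ ℕ λ t → t < ℓ × rowBlock (cell t) ≡ true × rowIndex (cell t) ≡ i
    rightColumns-covered : ∀ j → j < K m → Σ ℕ λ t → t < ℓ × colBlock (cell t) ≡ true × colIndex (cell t) ≡ j
    K≤ℓ : K m ≤ ℓ
    evenSymbols : ∀ x → x < K m → symbolAt m (cell x) ≡ evenSymbol m x
    corner-blocked : (Σ ℕ λ t → t < ℓ × symbolAt m (cell t) ≡ K m)
                   ⊎ (Σ ℕ λ t → t < ℓ × colBlock (cell t) ≡ false × colIndex (cell t) ≡ 0)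

  uncovered-symbol-used : ∀ p i q j → i < K m → j < K m →
    (∀ t → t < ℓ → rowBlock (cell t) ≡ p → rowIndex (cell t) ≡ i → ⊥) →
    (∀ t → t < ℓ → colBlock (cell t) ≡ q → colIndex (cell t) ≡ j → ⊥) →
    Σ ℕ λ t → t < ℓ × symbolAt m (cell t) ≡ blockSymbol m p i q j
  uncovered-symbol-used true i q j i<K j<K row-free col-free with lowerRows-covered i i<K
  ... | t , t<ℓ , e₁ , e₂ = ⊥-elim (row-free t t<ℓ e₁ e₂)
  uncovered-symbol-used false i true j i<K j<K row-free col-free with rightColumns-covered j j<K
  ... | t , t<ℓ , e₁ , e₂ = ⊥-elim (col-free t t<ℓ e₁ e₂)
  uncovered-symbol-used false i false j i<K j<K row-free col-free with isSpecialCell m false i false j in s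
  ... | true with corner-blocked
  ...   | inj₁ (t , t<ℓ , e) = t , t<ℓ , e
  ...   | inj₂ (t , t<ℓ , e₁ , e₂) = ⊥-elim (col-free t t<ℓ e₁ (trans e₂ (sym (proj₂ (isSpecialCell⇒ m false i false j s)))))
  uncovered-symbol-used false i false j i<K j<K row-free col-free | false =
    x , <-≤-trans (oddPreimage<K m h) K≤ℓ , trans (evenSymbols x (oddPreimage<K m h))
      (cong (λ z → 2 * z + 0) (trans (2*oddPreimage+1 m h) (m%n%n≡m%n (i + 0 + j) (K m))))
    where
    h x : ℕ
    h = (i + 0 + j) % K m
    x = oddPreimage m h

module _ {m ℓ : ℕ} (D : BlockDesign m ℓ) where
  open BlockDesign D
  open LabelledCell

  private
    rowAt colAt : ℕ → ℕ
    rowAt t = blockIndex m (rowBlock (cell t)) (rowIndex (cell t))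
    colAt t = blockIndex m (colBlock (cell t)) (colIndex (cell t))

    finCell : ℕ → Cell (ord m)
    finCell t = finOrd m (rowAt t) , finOrd m (colAt t)

    cells : List (Cell (ord m))
    cells = applyUpTo finCell ℓ

    finCell∈cells : ∀ {t} → t < ℓ → finCell t ∈ cells
    finCell∈cells = ∈-applyUpTo⁺ finCell

    row-finCell : ∀ t → t < ℓ → toℕ (proj₁ (finCell t)) ≡ rowAt t
    row-finCell t t<ℓ = toℕ-finOrd m _ (blockIndex<ord m (rowBlock (cell t)) _ (rowIndex<K (labelled t t<ℓ)))

    col-finCell : ∀ t → t < ℓ → toℕ (proj₂ (finCell t)) ≡ colAt t
    col-finCell t t<ℓ = toℕ-finOrd m _ (blockIndex<ord m (colBlock (cell t)) _ (colIndex<K (labelled t t<ℓ)))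

    symbol-finCell : ∀ t → t < ℓ → toℕ (symbolOf (Mstar m) (finCell t)) ≡ symbolAt m (cell t)
    symbol-finCell t t<ℓ = Mstar≡blockSymbol m _ _ _ _ _ _ (rowIndex<K (labelled t t<ℓ)) (colIndex<K (labelled t t<ℓ))
                                             (row-finCell t t<ℓ) (col-finCell t t<ℓ)

    Unique-map-cells : (f : Cell (ord m) → Fin (ord m)) →
      (∀ t t′ → t < ℓ → t′ < ℓ → f (finCell t) ≡ f (finCell t′) → t ≡ t′) → Unique (map f cells)
    Unique-map-cells f inj = subst Unique (sym (map-applyUpTo finCell f ℓ))
      (applyUpTo⁺₁ (f ∘ finCell) ℓ (λ t<t′ t′<ℓ e → <⇒≢ t<t′ (inj _ _ (<-trans t<t′ t′<ℓ) t′<ℓ e)))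

    cells-PT : IsPartialTransversal (Mstar m) cells
    cells-PT = Unique-map-cells proj₁ rows-distinct , Unique-map-cells proj₂ cols-distinct ,
               Unique-map-cells (symbolOf (Mstar m)) symbols-distinct
      where
      rows-distinct : ∀ t t′ → t < ℓ → t′ < ℓ → proj₁ (finCell t) ≡ proj₁ (finCell t′) → t ≡ t′
      rows-distinct t t′ t<ℓ t′<ℓ e
        with blockIndex-injective m _ _ _ _ (rowIndex<K (labelled t t<ℓ)) (rowIndex<K (labelled t′ t′<ℓ))
               (trans (sym (row-finCell t t<ℓ)) (trans (cong toℕ e) (row-finCell t′ t′<ℓ)))
      ... | e₁ , e₂ = trans (sym (rowLabel≡ (labelled t t<ℓ))) (trans (cong₂ rowLabel e₁ e₂) (rowLabel≡ (labelled t′ t′<ℓ)))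
      cols-distinct : ∀ t t′ → t < ℓ → t′ < ℓ → proj₂ (finCell t) ≡ proj₂ (finCell t′) → t ≡ t′
      cols-distinct t t′ t<ℓ t′<ℓ e
        with blockIndex-injective m _ _ _ _ (colIndex<K (labelled t t<ℓ)) (colIndex<K (labelled t′ t′<ℓ))
               (trans (sym (col-finCell t t<ℓ)) (trans (cong toℕ e) (col-finCell t′ t′<ℓ)))
      ... | e₁ , e₂ = trans (sym (colLabel≡ (labelled t t<ℓ))) (trans (cong₂ colLabel e₁ e₂) (colLabel≡ (labelled t′ t′<ℓ)))
      symbols-distinct : ∀ t t′ → t < ℓ → t′ < ℓ →
        symbolOf (Mstar m) (finCell t) ≡ symbolOf (Mstar m) (finCell t′) → t ≡ t′
      symbols-distinct t t′ t<ℓ t′<ℓ e = trans (sym (symbolLabel≡ (labelled t t<ℓ)))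
        (trans (cong symbolLabel (trans (sym (symbol-finCell t t<ℓ)) (trans (cong toℕ e) (symbol-finCell t′ t′<ℓ))))
               (symbolLabel≡ (labelled t′ t′<ℓ)))

    cells-blocked : Blocked (Mstar m) cells
    cells-blocked r c r∉ c∉ with blockCoordinates m r | blockCoordinates m c
    ... | p , i , i<K , r≡ | q , j , j<K , c≡ with uncovered-symbol-used p i q j i<K j<K row-free col-free
      where
      row-free : ∀ t → t < ℓ → rowBlock (cell t) ≡ p → rowIndex (cell t) ≡ i → ⊥
      row-free t t<ℓ refl refl = r∉ (subst (_∈ map proj₁ cells)
        (toℕ-injective (trans (row-finCell t t<ℓ) (sym r≡))) (∈-map⁺ proj₁ (finCell∈cells t<ℓ)))
      col-free : ∀ t → t < ℓ → colBlock (cell t) ≡ q → colIndex (cell t) ≡ j → ⊥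
      col-free t t<ℓ refl refl = c∉ (subst (_∈ map proj₂ cells)
        (toℕ-injective (trans (col-finCell t t<ℓ) (sym c≡))) (∈-map⁺ proj₂ (finCell∈cells t<ℓ)))
    ... | t , t<ℓ , e = subst (_∈ map (symbolOf (Mstar m)) cells)
      (toℕ-injective (trans (symbol-finCell t t<ℓ) (trans e (sym (Mstar≡blockSymbol m r c p i q j i<K j<K r≡ c≡)))))
      (∈-map⁺ (symbolOf (Mstar m)) (finCell∈cells t<ℓ))

  BlockDesign⇒maximal : HasMaximalPTOfLength (Mstar m) ℓ
  BlockDesign⇒maximal = cells , blocked⇒maximal (Mstar m) cells cells-PT cells-blocked , length-applyUpTo finCell ℓ

-- The parity argument

-- nab (resp. mab) is the number of free columns (resp. rows) lying in block a that are (b = 1)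
-- or are not (b = 0) the special line of that block, and O the number of odd symbols used;
-- rowab and colab count the odd symbols along a free line of class ab.
record ParityCounts (m O n00 n01 n10 n11 m00 m01 m10 m11 : ℕ) : Set where
  field
    1≤m : 1 ≤ m
    n-sum : n00 + n01 + n10 + n11 ≡ K m
    m-sum : m00 + m01 + m10 + m11 ≡ K m
    n01≤1 : n01 ≤ 1
    n11≤1 : n11 ≤ 1
    m01≤1 : m01 ≤ 1
    m11≤1 : m11 ≤ 1
    n00<K : n00 < K m
    n10<K : n10 < K m
    m00<K : m00 < K m
    m10<K : m10 < K m
    row00 : 0 < m00 → O ≡ n10 + n11
    row10 : 0 < m10 → O ≡ n00 + n01
    row01 : 0 < m01 → O ≡ n01 + n10
    row11 : 0 < m11 → O ≡ n00 + n11
    col00 : 0 < n00 → O ≡ m10 + m11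
    col10 : 0 < n10 → O ≡ m00 + m01
    col01 : 0 < n01 → O ≡ m01 + m10
    col11 : 0 < n11 → O ≡ m00 + m11

ParityCounts-swap : ∀ {m O n00 n01 n10 n11 m00 m01 m10 m11} →
  ParityCounts m O n00 n01 n10 n11 m00 m01 m10 m11 → ParityCounts m O n10 n11 n00 n01 m10 m11 m00 m01
ParityCounts-swap {n00 = n00} {n01} {n10} {n11} {m00} {m01} {m10} {m11} h = record
  { 1≤m = 1≤m ; n-sum = trans (swap n10 n11 n00 n01) n-sum ; m-sum = trans (swap m10 m11 m00 m01) m-sum
  ; n01≤1 = n11≤1 ; n11≤1 = n01≤1 ; m01≤1 = m11≤1 ; m11≤1 = m01≤1
  ; n00<K = n10<K ; n10<K = n00<K ; m00<K = m10<K ; m10<K = m00<K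
  ; row00 = row10 ; row10 = row00
  ; row01 = λ p → trans (row11 p) (+-comm n00 n11) ; row11 = λ p → trans (row01 p) (+-comm n01 n10)
  ; col00 = col10 ; col10 = col00
  ; col01 = λ p → trans (col11 p) (+-comm m00 m11) ; col11 = λ p → trans (col01 p) (+-comm m01 m10) }
  where
  open ParityCounts h
  swap : ∀ a b c d → a + b + c + d ≡ c + d + a + b
  swap = solve-∀

odd-total : ∀ m O a b c d → a + b + c + d ≡ K m → O ≡ a + b → O ≡ c + d → ⊥
odd-total m O a b c d total e₁ e₂ =
  K≢x+x m O (trans (sym total) (trans (+-assoc (a + b) c d) (cong₂ _+_ (sym e₁) (sym e₂))))

≤1+≤1≢K : ∀ m a b → 1 ≤ m → a ≤ 1 → b ≤ 1 → a + b ≢ K m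
≤1+≤1≢K m a b 1≤m a≤1 b≤1 e = <⇒≱ (≤-trans (3≤K m 1≤m) (≤-reflexive (sym e))) (+-mono-≤ a≤1 b≤1)

private
  +0+0+0 : ∀ a → a + 0 + 0 + 0 ≡ a
  +0+0+0 = solve-∀

first-block-columns-only : ∀ {m O n00 n01 n11 m00 m01 m11} →
  ParityCounts m O (suc n00) n01 0 n11 m00 m01 0 m11 → 0 < m00 → ⊥
first-block-columns-only {m11 = suc (suc _)} h _ with ParityCounts.m11≤1 h
... | s≤s ()
first-block-columns-only {n00 = n00} {n11 = n11} {m11 = 1} h m00>0 = m≢1+n+m 1 (trans one≡ (cong (suc n00 +_) n11≡1))
  where
  open ParityCounts h
  one≡ : 1 ≡ suc n00 + n11
  one≡ = trans (sym (col00 z<s)) (row11 z<s)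
  n11≡1 : n11 ≡ 1
  n11≡1 = trans (sym (row00 m00>0)) (col00 z<s)
first-block-columns-only {n01 = 0} {n11} {m11 = 0} h m00>0 =
  <-irrefl (trans (sym (+0+0+0 (suc _))) (trans (cong (suc _ + 0 + 0 +_) (sym n11≡0)) n-sum)) n00<K
  where
  open ParityCounts h
  n11≡0 : n11 ≡ 0
  n11≡0 = trans (sym (row00 m00>0)) (col00 z<s)
first-block-columns-only {n01 = 1} {m00 = m00} {m01} {m11 = 0} h m00>0 =
  <-irrefl (trans (sym (+0+0+0 m00)) (trans (cong (λ z → m00 + z + 0 + 0) (sym m01≡0)) m-sum)) m00<K
  where
  open ParityCounts h
  m01≡0 : m01 ≡ 0
  m01≡0 = trans (sym (+-identityʳ m01)) (trans (sym (col01 z<s)) (col00 z<s))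
first-block-columns-only {n01 = suc (suc _)} {m11 = 0} h _ with ParityCounts.n01≤1 h
... | s≤s ()

second-block-columns-only : ∀ {m O n01 n10 n11 m00 m01 m11} →
  ParityCounts m O 0 n01 (suc n10) n11 m00 m01 0 m11 → 0 < m00 → ⊥
second-block-columns-only {m11 = suc (suc _)} h _ with ParityCounts.m11≤1 h
... | s≤s ()
second-block-columns-only {m} {O} {n11 = n11} {m00} {m01} {m11 = 1} h _ =
  <⇒≱ (s≤s (+-monoˡ-≤ 1 n11≤1)) (subst (3 ≤_) (trans K≡O+1 (cong (_+ 1) O≡n11)) (3≤K m 1≤m))
  where
  open ParityCounts h
  O≡n11 : O ≡ n11
  O≡n11 = row11 z<s
  K≡O+1 : K m ≡ O + 1
  K≡O+1 = trans (sym m-sum) (trans (regroup m00 m01) (cong (_+ 1) (sym (col10 z<s))))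
    where
    regroup : ∀ a b → a + b + 0 + 1 ≡ (a + b) + 1
    regroup = solve-∀
second-block-columns-only {m01 = 0} {m11 = 0} h _ =
  <-irrefl (trans (sym (+0+0+0 _)) (ParityCounts.m-sum h)) (ParityCounts.m00<K h)
second-block-columns-only {m} {O} {n01} {n10} {n11} {m00} {m01 = 1} {m11 = 0} h m00>0 =
  <-irrefl (trans (sym (+-identityʳ (suc n10))) (trans (cong (suc n10 +_) (sym n11≡0)) (trans (sym O≡) O≡K))) n10<K
  where
  open ParityCounts h
  O≡K : O ≡ K m
  O≡K = trans (col10 z<s) (trans (sym (regroup m00)) m-sum)
    where
    regroup : ∀ a → a + 1 + 0 + 0 ≡ a + 1
    regroup = solve-∀
  O≡ : O ≡ suc n10 + n11
  O≡ = row00 m00>0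
  n01≡n11 : n01 ≡ n11
  n01≡n11 = +-cancelʳ-≡ (suc n10) n01 n11 (trans (sym (row01 z<s)) (trans O≡ (+-comm (suc n10) n11)))
  n01≡0 : n01 ≡ 0
  n01≡0 = +-cancelʳ-≡ (suc n10 + n11) n01 0 (trans (regroup n01 (suc n10) n11) (trans n-sum (trans (sym O≡K) O≡)))
    where
    regroup : ∀ a b c → a + (b + c) ≡ 0 + a + b + c
    regroup = solve-∀
  n11≡0 : n11 ≡ 0
  n11≡0 = trans (sym n01≡n11) n01≡0
second-block-columns-only {m01 = suc (suc _)} {m11 = 0} h _ with ParityCounts.m01≤1 h
... | s≤s ()

-- Free regular rows in both blocks, or free regular columns in both blocks, would split the odd
-- total K m into two equal halves.
first-block-rows-impossible : ∀ {m O n00 n01 n10 n11 m00 m01 m10 m11} →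
  ParityCounts m O n00 n01 n10 n11 m00 m01 m10 m11 → 0 < m00 → ⊥
first-block-rows-impossible {m} {O} {n00} {n01} {n10} {n11} {m10 = suc _} h m00>0 =
  odd-total m O n00 n01 n10 n11 (ParityCounts.n-sum h) (ParityCounts.row10 h z<s) (ParityCounts.row00 h m00>0)
first-block-rows-impossible {m} {O} {suc _} {n10 = suc _} {m00 = m00} {m01} {zero} {m11} h _ =
  odd-total m O m00 m01 0 m11 (ParityCounts.m-sum h) (ParityCounts.col10 h z<s) (ParityCounts.col00 h z<s)
first-block-rows-impossible {m} {n00 = zero} {n01} {zero} {n11} {m10 = zero} h _ =
  ≤1+≤1≢K m n01 n11 (ParityCounts.1≤m h) (ParityCounts.n01≤1 h) (ParityCounts.n11≤1 h)
    (trans (cong (_+ n11) (sym (+-identityʳ n01))) (ParityCounts.n-sum h))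
first-block-rows-impossible {n00 = suc _} {n10 = zero} {m10 = zero} h m00>0 = first-block-columns-only h m00>0
first-block-rows-impossible {n00 = zero} {n10 = suc _} {m10 = zero} h m00>0 = second-block-columns-only h m00>0

ParityCounts-impossible : ∀ {m O n00 n01 n10 n11 m00 m01 m10 m11} → ¬ ParityCounts m O n00 n01 n10 n11 m00 m01 m10 m11
ParityCounts-impossible {m00 = suc _} h = first-block-rows-impossible h z<s
ParityCounts-impossible {m10 = suc _} h = first-block-rows-impossible (ParityCounts-swap h) z<s
ParityCounts-impossible {m} {m00 = zero} {m01} {zero} {m11} h =
  ≤1+≤1≢K m m01 m11 (ParityCounts.1≤m h) (ParityCounts.m01≤1 h) (ParityCounts.m11≤1 h)
    (trans (cong (_+ m11) (sym (+-identityʳ m01))) (ParityCounts.m-sum h))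

_≐_ : Bool → Bool → Bool
a ≐ b = not (a xor b)

≐⇒≡ : ∀ {a b} → (a ≐ b) ≡ true → a ≡ b
≐⇒≡ {false} {false} _ = refl
≐⇒≡ {true} {true} _ = refl

classCount : ∀ {n} (U s z : Fin n → Bool) → Bool → Bool → ℕ
classCount U s z a b = count (λ x → U x ∧ ((s x ≐ a) ∧ (z x ≐ b)))

weightedSum : (Bool → Bool → Bool) → (Bool → Bool → ℕ) → ℕ
weightedSum φ c = bit (φ false false) * c false false + bit (φ false true) * c false true +
                  bit (φ true false) * c true false + bit (φ true true) * c true true

count-byClass : ∀ {n} (U s z : Fin n → Bool) (φ : Bool → Bool → Bool) →
  count (λ x → U x ∧ φ (s x) (z x)) ≡ weightedSum φ (classCount U s z)
count-byClass {zero} U s z φ = zeros (bit (φ false false)) (bit (φ false true)) (bit (φ true false)) (bit (φ true true))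
  where
  zeros : ∀ a b c d → 0 ≡ a * 0 + b * 0 + c * 0 + d * 0
  zeros = solve-∀
count-byClass {suc n} U s z φ =
  trans (cong₂ _+_ (head (U zero) (s zero) (z zero)) (count-byClass (U ∘ suc) (s ∘ suc) (z ∘ suc) φ))
        (distribute φ₀₀ φ₀₁ φ₁₀ φ₁₁ _ _ _ _ _ _ _ _)
  where
  distribute : ∀ a b c d x₀ x₁ x₂ x₃ y₀ y₁ y₂ y₃ →
    (a * x₀ + b * x₁ + c * x₂ + d * x₃) + (a * y₀ + b * y₁ + c * y₂ + d * y₃) ≡
    a * (x₀ + y₀) + b * (x₁ + y₁) + c * (x₂ + y₂) + d * (x₃ + y₃)
  distribute = solve-∀
  φ₀₀ φ₀₁ φ₁₀ φ₁₁ : ℕ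
  φ₀₀ = bit (φ false false)
  φ₀₁ = bit (φ false true)
  φ₁₀ = bit (φ true false)
  φ₁₁ = bit (φ true true)
  head : ∀ u a b → bit (u ∧ φ a b) ≡
    bit (φ false false) * bit (u ∧ ((a ≐ false) ∧ (b ≐ false))) + bit (φ false true) * bit (u ∧ ((a ≐ false) ∧ (b ≐ true))) +
    bit (φ true false) * bit (u ∧ ((a ≐ true) ∧ (b ≐ false))) + bit (φ true true) * bit (u ∧ ((a ≐ true) ∧ (b ≐ true)))
  head false a b = none φ₀₀ φ₀₁ φ₁₀ φ₁₁
    where
    none : ∀ a b c d → 0 ≡ a * 0 + b * 0 + c * 0 + d * 0
    none = solve-∀
  head true false false = first φ₀₀ φ₀₁ φ₁₀ φ₁₁
    where
    first : ∀ a b c d → a ≡ a * 1 + b * 0 + c * 0 + d * 0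
    first = solve-∀
  head true false true = second φ₀₀ φ₀₁ φ₁₀ φ₁₁
    where
    second : ∀ a b c d → b ≡ a * 0 + b * 1 + c * 0 + d * 0
    second = solve-∀
  head true true false = third φ₀₀ φ₀₁ φ₁₀ φ₁₁
    where
    third : ∀ a b c d → c ≡ a * 0 + b * 0 + c * 1 + d * 0
    third = solve-∀
  head true true true = fourth φ₀₀ φ₀₁ φ₁₀ φ₁₁
    where
    fourth : ∀ a b c d → d ≡ a * 0 + b * 0 + c * 0 + d * 1
    fourth = solve-∀

classCount-sum : ∀ {n} (U s z : Fin n → Bool) →
  classCount U s z false false + classCount U s z false true + classCount U s z true false + classCount U s z true true ≡ count U
classCount-sum U s z = begin
  c₀₀ + c₀₁ + c₁₀ + c₁₁                              ≡⟨ ones c₀₀ c₀₁ c₁₀ c₁₁ ⟨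
  1 * c₀₀ + 1 * c₀₁ + 1 * c₁₀ + 1 * c₁₁              ≡⟨ count-byClass U s z (λ _ _ → true) ⟨
  count (λ x → U x ∧ true)                           ≡⟨ count-cong (∧-identityʳ ∘ U) ⟩
  count U                                            ∎
  where
  open ≡-Reasoning
  c₀₀ c₀₁ c₁₀ c₁₁ : ℕ
  c₀₀ = classCount U s z false false
  c₀₁ = classCount U s z false true
  c₁₀ = classCount U s z true false
  c₁₁ = classCount U s z true true
  ones : ∀ a b c d → 1 * a + 1 * b + 1 * c + 1 * d ≡ a + b + c + d
  ones = solve-∀

classCount-witness : ∀ {n} (U s z : Fin n → Bool) a b → 0 < classCount U s z a b →
  Σ (Fin n) λ x → U x ≡ true × s x ≡ a × z x ≡ b
classCount-witness U s z a b positive with count-witness _ positive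
... | x , e with ∧≡true {U x} e
... | Ux , e′ with ∧≡true {s x ≐ a} e′
... | sx , zx = x , Ux , ≐⇒≡ sx , ≐⇒≡ zx

classCount-mono : ∀ {n} (U s z : Fin n → Bool) a b (V : Fin n → Bool) →
  (∀ x → s x ≡ a → z x ≡ b → V x ≡ true) → classCount U s z a b ≤ count V
classCount-mono U s z a b V h = count-mono _ V in-V
  where
  in-V : ∀ x → (U x ∧ ((s x ≐ a) ∧ (z x ≐ b))) ≡ true → V x ≡ true
  in-V x e with ∧≡true {U x} e
  ... | _ , e′ with ∧≡true {s x ≐ a} e′
  ... | sx , zx = h x (≐⇒≡ sx) (≐⇒≡ zx)

-- If an injection g maps a set U into a set S of the same size, it maps U onto S, so it
-- preserves the number of elements satisfying any predicate P.
count-transfer : ∀ {n} (U S P : Fin n → Bool) (g : Fin n → Fin n) → (∀ x y → g x ≡ g y → x ≡ y) →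
  (∀ x → U x ≡ true → S (g x) ≡ true) → count U ≡ count S →
  count (λ x → U x ∧ P (g x)) ≡ count (λ s → S s ∧ P s)
count-transfer U S P g g-injective U→S same-size = squeeze (part P) (part (not ∘ P))
  (trans (sym (count-split U (P ∘ g))) (trans same-size (count-split S P)))
  where
  part : (Q : Fin _ → Bool) → count (λ x → U x ∧ Q (g x)) ≤ count (λ s → S s ∧ Q s)
  part Q = count-injection _ _ g maps g-injective
    where
    maps : ∀ x → (U x ∧ Q (g x)) ≡ true → (S (g x) ∧ Q (g x)) ≡ true
    maps x e with ∧≡true {U x} e
    ... | Ux , Qgx rewrite U→S x Ux = Qgx
  squeeze : ∀ {a b c d} → a ≤ b → c ≤ d → a + c ≡ b + d → a ≡ b
  squeeze {a} {b} {c} {d} a≤b c≤d e =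
    ≤-antisym a≤b (+-cancelʳ-≤ d b a (≤-trans (≤-reflexive (sym e)) (+-monoʳ-≤ a c≤d)))

isOdd : ℕ → Bool
isOdd v = (v % 2) == 1

isOdd-blockSymbol : ∀ m p i q j → isOdd (blockSymbol m p i q j) ≡ (p xor q) xor isSpecialCell m p i q j
isOdd-blockSymbol m p i q j with isSpecialCell m p i q j
... | false rewrite [2h+e]%2≡e ((i + bit (p ∧ q) + j) % K m) (bit (p xor q)) (bit≤1 (p xor q)) =
  trans (bit==1 (p xor q)) (sym (xor-identityʳ (p xor q)))
  where
  bit==1 : ∀ b → (bit b == 1) ≡ b
  bit==1 true = refl
  bit==1 false = refl
... | true = special p q
  where
  K-odd : isOdd (K m) ≡ true
  K-odd = cong (_== 1) (trans (cong (_% 2) (K≡2m+1 m)) ([2h+e]%2≡e m 1 (s≤s z≤n)))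
  special : ∀ p q → isOdd (specialSymbol m p q) ≡ (p xor q) xor true
  special false false = K-odd
  special false true = refl
  special true false = refl
  special true true = K-odd

secondBlock : ∀ m → Fin (ord m) → Bool
secondBlock m x = not (toℕ x <ᵇ K m)

specialLine : ∀ m → Fin (ord m) → Bool
specialLine m x = (toℕ x == 0) ∨ (toℕ x == (K m + m))

secondBlock-blockIndex : ∀ m (x : Fin (ord m)) p i → i < K m → toℕ x ≡ blockIndex m p i → secondBlock m x ≡ p
secondBlock-blockIndex m x false i i<K x≡ rewrite x≡ | <ᵇ-true i<K = refl
secondBlock-blockIndex m x true i i<K x≡ rewrite x≡ | <ᵇ-false (m≤m+n (K m) i) = refl

specialLine-blockIndex : ∀ m (x : Fin (ord m)) p i → i < K m → toℕ x ≡ blockIndex m p i →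
  specialLine m x ≡ (i == specialIndex m p)
specialLine-blockIndex m x false i i<K x≡
  rewrite x≡ | ==-≢ {i} {K m + m} (<⇒≢ (<-≤-trans i<K (m≤m+n (K m) m))) = ∨-identityʳ (i == 0)
specialLine-blockIndex m x true i i<K x≡
  rewrite x≡ | ==-≢ {K m + i} {0} (λ ()) | ==-cancelˡ (K m) i m = refl

isOdd-Mstar : ∀ m r c →
  isOdd (toℕ (Mstar m r c)) ≡ (secondBlock m r xor secondBlock m c) xor (specialLine m r ∧ specialLine m c)
isOdd-Mstar m r c with blockCoordinates m r | blockCoordinates m c
... | p , i , i<K , r≡ | q , j , j<K , c≡
  rewrite Mstar≡blockSymbol m r c p i q j i<K j<K r≡ c≡
        | secondBlock-blockIndex m r p i i<K r≡ | secondBlock-blockIndex m c q j j<K c≡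
        | specialLine-blockIndex m r p i i<K r≡ | specialLine-blockIndex m c q j j<K c≡ = isOdd-blockSymbol m p i q j

specialLine-unique : ∀ m (x y : Fin (ord m)) → secondBlock m x ≡ secondBlock m y →
  specialLine m x ≡ true → specialLine m y ≡ true → x ≡ y
specialLine-unique m x y same-block x-special y-special with blockCoordinates m x | blockCoordinates m y
... | p , i , i<K , x≡ | q , j , j<K , y≡
  with trans (sym (secondBlock-blockIndex m x p i i<K x≡)) (trans same-block (secondBlock-blockIndex m y q j j<K y≡))
... | refl = toℕ-injective (begin
  toℕ x                         ≡⟨ x≡ ⟩
  blockIndex m p i              ≡⟨ cong (blockIndex m p) (==⇒≡ (trans (sym (specialLine-blockIndex m x p i i<K x≡)) x-special)) ⟩
  blockIndex m p (specialIndex m p) ≡⟨ cong (blockIndex m p) (==⇒≡ (trans (sym (specialLine-blockIndex m y p j j<K y≡)) y-special)) ⟨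
  blockIndex m p j              ≡⟨ y≡ ⟨
  toℕ y                         ∎)
  where open ≡-Reasoning

specialIndex<K : ∀ m p → specialIndex m p < K m
specialIndex<K m false = s≤s z≤n
specialIndex<K m true = m<K m

specialLineOf : ∀ m → Bool → Fin (ord m)
specialLineOf m p = finOrd m (blockIndex m p (specialIndex m p))

specialLineOf-coordinates : ∀ m p → toℕ (specialLineOf m p) ≡ blockIndex m p (specialIndex m p)
specialLineOf-coordinates m p = toℕ-finOrd m _ (blockIndex<ord m p _ (specialIndex<K m p))

secondBlock-specialLineOf : ∀ m p → secondBlock m (specialLineOf m p) ≡ p
secondBlock-specialLineOf m p = secondBlock-blockIndex m _ p _ (specialIndex<K m p) (specialLineOf-coordinates m p)

specialLine-specialLineOf : ∀ m p → specialLine m (specialLineOf m p) ≡ true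
specialLine-specialLineOf m p = trans (specialLine-blockIndex m _ p _ (specialIndex<K m p) (specialLineOf-coordinates m p))
                                      (==-refl (specialIndex m p))

block-size : ∀ m p → count (λ x → secondBlock m x ≐ p) ≡ K m
block-size m false = trans (count-cong {ord m} (λ x → in-first (toℕ x <ᵇ K m))) (count-toℕ< {ord m} (K m) (<⇒≤ (K<ord m)))
  where
  in-first : ∀ b → (not b ≐ false) ≡ b
  in-first false = refl
  in-first true = refl
block-size m true = +-cancelˡ-≡ (K m) _ _ (begin
  K m + count (λ x → secondBlock m x ≐ true)     ≡⟨ cong₂ _+_ (sym (count-toℕ< {ord m} (K m) (<⇒≤ (K<ord m))))
                                                              (count-cong {ord m} (λ x → in-second (toℕ x <ᵇ K m))) ⟩
  count first + count (not ∘ first)              ≡⟨ count-complement first ⟩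
  ord m                                          ≡⟨ ord≡K+K m ⟩
  K m + K m                                      ∎)
  where
  open ≡-Reasoning
  first : Fin (ord m) → Bool
  first x = toℕ x <ᵇ K m
  in-second : ∀ b → (not b ≐ true) ≡ not b
  in-second false = refl
  in-second true = refl

classCount-special≤1 : ∀ m (U : Fin (ord m) → Bool) p → classCount U (secondBlock m) (specialLine m) p true ≤ 1
classCount-special≤1 m U p with classCount U (secondBlock m) (specialLine m) p true in c
... | zero = z≤n
... | suc c′ with classCount-witness U (secondBlock m) (specialLine m) p true (subst (0 <_) (sym c) z<s)
... | y , _ , y-block , y-special = subst (_≤ 1) c (≤-trans
        (classCount-mono U (secondBlock m) (specialLine m) p true (_==ᶠ y)
          (λ x x-block x-special → subst (λ z → (x ==ᶠ z) ≡ true)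
             (specialLine-unique m x y (trans x-block (sym y-block)) x-special y-special) (==ᶠ-refl x)))
        (≤-reflexive (count-single y)))

classCount-regular<K : ∀ m (U : Fin (ord m) → Bool) p → classCount U (secondBlock m) (specialLine m) p false < K m
classCount-regular<K m U p = <-≤-trans
  (≤-<-trans (classCount-mono U (secondBlock m) (specialLine m) p false regular regular-line)
             (m<n+m (count regular) (count-positive special (specialLineOf m p) special-line)))
  (≤-reflexive (trans (sym (count-split inBlock (specialLine m))) (block-size m p)))
  where
  inBlock regular special : Fin (ord m) → Bool
  inBlock x = secondBlock m x ≐ p
  regular x = inBlock x ∧ not (specialLine m x)
  special x = inBlock x ∧ specialLine m x
  ≐-refl : ∀ b → (b ≐ b) ≡ true
  ≐-refl false = refl
  ≐-refl true = refl
  regular-line : ∀ x → secondBlock m x ≡ p → specialLine m x ≡ false → regular x ≡ true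
  regular-line x refl nonspecial rewrite ≐-refl (secondBlock m x) | nonspecial = refl
  special-line : special (specialLineOf m p) ≡ true
  special-line rewrite secondBlock-specialLineOf m p | ≐-refl p = specialLine-specialLineOf m p

module _ (m : ℕ) (1≤m : 1 ≤ m) (T : List (Cell (ord m))) (T-maximal : IsMaximalPT (Mstar m) T)
         (T-length : length T ≡ K m) where

  private
    L : Square (ord m)
    L = Mstar m

    usedSymbol freeRow freeCol : Fin (ord m) → Bool
    usedSymbol s = s ∈ᵇ map (symbolOf L) T
    freeRow r = not (r ∈ᵇ map proj₁ T)
    freeCol c = not (c ∈ᵇ map proj₂ T)

    used-count : (f : Cell (ord m) → Fin (ord m)) → Unique (map f T) → count (_∈ᵇ map f T) ≡ K m
    used-count f u = trans (count-∈ᵇ (map f T) u) (trans (length-map f T) T-length)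

    free-count : (f : Cell (ord m) → Fin (ord m)) → Unique (map f T) → count (not ∘ (_∈ᵇ map f T)) ≡ K m
    free-count f u = +-cancelˡ-≡ (K m) _ _
      (trans (cong (_+ count (not ∘ (_∈ᵇ map f T))) (sym (used-count f u)))
             (trans (count-complement (_∈ᵇ map f T)) (ord≡K+K m)))

    rows-unique : Unique (map proj₁ T)
    rows-unique = proj₁ (proj₁ T-maximal)
    cols-unique : Unique (map proj₂ T)
    cols-unique = proj₁ (proj₂ (proj₁ T-maximal))
    symbols-unique : Unique (map (symbolOf L) T)
    symbols-unique = proj₂ (proj₂ (proj₁ T-maximal))

    free⇒∉ : ∀ {y : Fin (ord m)} xs → not (y ∈ᵇ xs) ≡ true → y ∉ xs
    free⇒∉ {y} xs free y∈ = true≢false (trans (sym (∈⇒∈ᵇ y∈)) (trans (sym (not-involutive (y ∈ᵇ xs))) (cong not free)))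

    free-cell-symbol-used : ∀ r c → freeRow r ≡ true → freeCol c ≡ true → usedSymbol (L r c) ≡ true
    free-cell-symbol-used r c r-free c-free =
      ∈⇒∈ᵇ (maximal⇒blocked L T T-maximal r c (free⇒∉ (map proj₁ T) r-free) (free⇒∉ (map proj₂ T) c-free))

    O : ℕ
    O = count (λ s → usedSymbol s ∧ isOdd (toℕ s))

    odd-along-row : ∀ r → freeRow r ≡ true → count (λ c → freeCol c ∧ isOdd (toℕ (L r c))) ≡ O
    odd-along-row r r-free = count-transfer freeCol usedSymbol (isOdd ∘ toℕ) (L r)
      (λ _ _ → Mstar-row-injective m r) (λ c c-free → free-cell-symbol-used r c r-free c-free)
      (trans (free-count proj₂ cols-unique) (sym (used-count (symbolOf L) symbols-unique)))

    odd-along-col : ∀ c → freeCol c ≡ true → count (λ r → freeRow r ∧ isOdd (toℕ (L r c))) ≡ O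
    odd-along-col c c-free = count-transfer freeRow usedSymbol (isOdd ∘ toℕ) (λ r → L r c)
      (λ _ _ → proj₂ (Mstar-latin m) c) (λ r r-free → free-cell-symbol-used r c r-free c-free)
      (trans (free-count proj₁ rows-unique) (sym (used-count (symbolOf L) symbols-unique)))

    N M : Bool → Bool → ℕ
    N = classCount freeCol (secondBlock m) (specialLine m)
    M = classCount freeRow (secondBlock m) (specialLine m)

    row-class : ∀ a b → 0 < M a b → O ≡ weightedSum (λ a′ b′ → (a xor a′) xor (b ∧ b′)) N
    row-class a b positive with classCount-witness freeRow (secondBlock m) (specialLine m) a b positive
    ... | r , r-free , refl , refl = trans (sym (odd-along-row r r-free))
      (trans (count-cong (λ c → cong (freeCol c ∧_) (isOdd-Mstar m r c)))
             (count-byClass freeCol (secondBlock m) (specialLine m) (λ a′ b′ → (a xor a′) xor (b ∧ b′))))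

    col-class : ∀ a b → 0 < N a b → O ≡ weightedSum (λ a′ b′ → (a′ xor a) xor (b′ ∧ b)) M
    col-class a b positive with classCount-witness freeCol (secondBlock m) (specialLine m) a b positive
    ... | c , c-free , refl , refl = trans (sym (odd-along-col c c-free))
      (trans (count-cong (λ r → cong (freeRow r ∧_) (isOdd-Mstar m r c)))
             (count-byClass freeRow (secondBlock m) (specialLine m) (λ a′ b′ → (a′ xor a) xor (b′ ∧ b))))

    parityCounts : ParityCounts m O (N false false) (N false true) (N true false) (N true true)
                                    (M false false) (M false true) (M true false) (M true true)
    parityCounts = record
      { 1≤m = 1≤m
      ; n-sum = trans (classCount-sum freeCol (secondBlock m) (specialLine m)) (free-count proj₂ cols-unique)
      ; m-sum = trans (classCount-sum freeRow (secondBlock m) (specialLine m)) (free-count proj₁ rows-unique)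
      ; n01≤1 = classCount-special≤1 m freeCol false ; n11≤1 = classCount-special≤1 m freeCol true
      ; m01≤1 = classCount-special≤1 m freeRow false ; m11≤1 = classCount-special≤1 m freeRow true
      ; n00<K = classCount-regular<K m freeCol false ; n10<K = classCount-regular<K m freeCol true
      ; m00<K = classCount-regular<K m freeRow false ; m10<K = classCount-regular<K m freeRow true
      ; row00 = λ p → trans (row-class false false p) (pick₂₃ (N false false) (N false true) (N true false) (N true true))
      ; row10 = λ p → trans (row-class true false p) (pick₀₁ (N false false) (N false true) (N true false) (N true true))
      ; row01 = λ p → trans (row-class false true p) (pick₁₂ (N false false) (N false true) (N true false) (N true true))
      ; row11 = λ p → trans (row-class true true p) (pick₀₃ (N false false) (N false true) (N true false) (N true true))
      ; col00 = λ p → trans (col-class false false p) (pick₂₃ (M false false) (M false true) (M true false) (M true true))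
      ; col10 = λ p → trans (col-class true false p) (pick₀₁ (M false false) (M false true) (M true false) (M true true))
      ; col01 = λ p → trans (col-class false true p) (pick₁₂ (M false false) (M false true) (M true false) (M true true))
      ; col11 = λ p → trans (col-class true true p) (pick₀₃ (M false false) (M false true) (M true false) (M true true)) }
      where
      pick₂₃ : ∀ a b c d → 0 * a + 0 * b + 1 * c + 1 * d ≡ c + d
      pick₂₃ = solve-∀
      pick₀₁ : ∀ a b c d → 1 * a + 1 * b + 0 * c + 0 * d ≡ a + b
      pick₀₁ = solve-∀
      pick₁₂ : ∀ a b c d → 0 * a + 1 * b + 1 * c + 0 * d ≡ b + c
      pick₁₂ = solve-∀
      pick₀₃ : ∀ a b c d → 1 * a + 0 * b + 0 * c + 1 * d ≡ a + d
      pick₀₃ = solve-∀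

  maximal-of-length-K-impossible : ⊥
  maximal-of-length-K-impossible = ParityCounts-impossible parityCounts

no-maximal-of-length-K : ∀ m → 1 ≤ m → ¬ HasMaximalPTOfLength (Mstar m) (2 * m + 1)
no-maximal-of-length-K m 1≤m (T , T-maximal , T-length) =
  maximal-of-length-K-impossible m 1≤m T T-maximal (trans T-length (sym (K≡2m+1 m)))

-- Maximal partial transversals of every length K m + j with 1 ≤ j ≤ K m

below-or-above : ∀ b t → t < b ⊎ Σ ℕ λ u → t ≡ b + u
below-or-above b t with t <? b
... | yes t<b = inj₁ t<b
... | no t≮b = inj₂ (t ∸ b , sym (m+[n∸m]≡n (≮⇒≥ t≮b)))

offset< : ∀ {b t s u} → t ≡ b + u → t < b + s → u < s
offset< {b} refl t<b+s = +-cancelˡ-< b _ _ t<b+s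

-- Both constructions use w = K m ∸ a.  The first K m cells carry the even symbols
-- evenSymbol m t, the remaining ones odd symbols 2 ((w + o) mod K m) + 1 with o < 2a, or the
-- symbol K m = 2 ((w + m + a) mod K m) + 1 of dₘₘ; symbolLabel reads the label back.
module DesignKit (m a : ℕ) (a≤m : a ≤ m) where
  k w : ℕ
  k = K m
  w = K m ∸ a

  m<k : m < k
  m<k = m<K m

  w+a≡k : w + a ≡ k
  w+a≡k = m∸n+n≡m (≤-trans a≤m (<⇒≤ m<k))

  w≤k : w ≤ k
  w≤k = m∸n≤m (K m) a

  m<w : m < w
  m<w = +-cancelʳ-< a m w (subst (m + a <_) (sym w+a≡k) (≤-<-trans (+-monoʳ-≤ m a≤m) (s≤s (≤-reflexive (cong (m +_) (sym (+-identityʳ m)))))))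

  a<w : a < w
  a<w = ≤-<-trans a≤m m<w

  0<w : 0 < w
  0<w = ≤-<-trans z≤n m<w

  a+a<k : a + a < k
  a+a<k = s≤s (≤-trans (+-mono-≤ a≤m a≤m) (≤-reflexive (cong (m +_) (sym (+-identityʳ m)))))

  u<k : ∀ u → u < a → u < k
  u<k u u<a = <-trans u<a (≤-<-trans a≤m m<k)

  1+u<k : ∀ u → u < a → 1 + u < k
  1+u<k u u<a = <-≤-trans (s≤s u<a) (≤-trans (s≤s a≤m) m<k)

  w+u<k : ∀ u → u < a → w + u < k
  w+u<k u u<a = subst (w + u <_) w+a≡k (+-monoʳ-< w u<a)

  w+u≢m : ∀ u → w + u ≢ m
  w+u≢m u e = <⇒≢ (<-≤-trans m<w (m≤m+n w u)) (sym e)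

  2u<a+a : ∀ u → u < a → 2 * u < a + a
  2u<a+a u u<a = subst (_< a + a) (sym (cong (u +_) (+-identityʳ u))) (+-mono-< u<a u<a)

  2u+1<a+a : ∀ u → u < a → 2 * u + 1 < a + a
  2u+1<a+a u u<a = subst (_≤ a + a) (regroup u) (+-mono-≤ u<a u<a)
    where
    regroup : ∀ u → suc u + suc u ≡ suc (2 * u + 1)
    regroup = solve-∀

  2u<k : ∀ u → u < a → 2 * u < k
  2u<k u u<a = <-trans (2u<a+a u u<a) a+a<k

  2u+1<k : ∀ u → u < a → 2 * u + 1 < k
  2u+1<k u u<a = <-trans (2u+1<a+a u u<a) a+a<k

  oddSymbol : ℕ → ℕ
  oddSymbol o = 2 * ((w + o) % k) + 1

  oddLabel : ℕ → ℕ
  oddLabel o = if o <ᵇ (a + a) then (if (o % 2) == 0 then k + o / 2 else k + a + o / 2) else k + (a + a)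

  symbolLabel : ℕ → ℕ
  symbolLabel v = if (v % 2) == 0 then oddPreimage m (v / 2) else oddLabel ((v / 2 + a) % k)

  symbolLabel-even : ∀ x → x < k → symbolLabel (evenSymbol m x) ≡ x
  symbolLabel-even x x<k
    rewrite [2h+e]%2≡e ((2 * x + 1) % k) 0 z≤n | [2h+e]/2≡h ((2 * x + 1) % k) 0 z≤n = oddPreimage-2x+1 m x x<k

  symbolLabel-odd : ∀ o → o < k → symbolLabel (oddSymbol o) ≡ oddLabel o
  symbolLabel-odd o o<k rewrite [2h+e]%2≡e ((w + o) % k) 1 (s≤s z≤n) = cong oddLabel (begin
    (oddSymbol o / 2 + a) % k ≡⟨ cong (λ z → (z + a) % k) ([2h+e]/2≡h ((w + o) % k) 1 (s≤s z≤n)) ⟩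
    ((w + o) % k + a) % k     ≡⟨ [m%d+n]%d≡[m+n]%d (w + o) a k ⟩
    (w + o + a) % k           ≡⟨ cong (_% k) (trans (regroup w o a) (cong (o +_) w+a≡k)) ⟩
    (o + k) % k               ≡⟨ [m+n]%n≡m%n o k ⟩
    o % k                     ≡⟨ m<n⇒m%n≡m o<k ⟩
    o                         ∎)
    where
    open ≡-Reasoning
    regroup : ∀ w o a → w + o + a ≡ o + (w + a)
    regroup = solve-∀

  oddLabel-2u : ∀ u → u < a → oddLabel (2 * u) ≡ k + u
  oddLabel-2u u u<a
    rewrite <ᵇ-true (2u<a+a u u<a)
          | sym (+-identityʳ (2 * u)) | [2h+e]%2≡e u 0 z≤n | [2h+e]/2≡h u 0 z≤n = refl

  oddLabel-2u+1 : ∀ u → u < a → oddLabel (2 * u + 1) ≡ k + a + u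
  oddLabel-2u+1 u u<a
    rewrite <ᵇ-true (2u+1<a+a u u<a) | [2h+e]%2≡e u 1 (s≤s z≤n) | [2h+e]/2≡h u 1 (s≤s z≤n) = refl

  oddLabel-m+a : oddLabel (m + a) ≡ k + (a + a)
  oddLabel-m+a rewrite <ᵇ-false (+-monoˡ-≤ a a≤m) = refl

  cellA : ℕ → BlockCell
  cellA t = ⟨ false , t ∣ false , suc t % k ⟩

  symbol-cellA : ∀ u → symbolAt m (cellA (w + u)) ≡ evenSymbol m (w + u)
  symbol-cellA u = trans (blockSymbol-regular m false (w + u) false (suc (w + u) % k) regular)
    (cong (λ z → 2 * z + 0) (trans ([m+n%d]%d≡[m+n]%d (w + u + 0) (suc (w + u)) k) (cong (_% k) (regroup (w + u)))))
    where
    regular : isSpecialCell m false (w + u) false (suc (w + u) % k) ≡ false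
    regular rewrite ==-≢ {w + u} {0} (λ e → <⇒≢ (<-≤-trans 0<w (m≤m+n w u)) (sym e)) = refl
    regroup : ∀ x → x + 0 + suc x ≡ 2 * x + 1
    regroup = solve-∀

-- The cells (row | column), each line given by its block and its index (u < a):
--   t < w, t ≠ m : (second t | second t)            t = m     : (first m | first m + 1)
--   t = w + u    : cellA (w + u)                    t = K + u : (first u | second w + u)
--   t = K + a + u : (second w + u | first 1 + u)     t = K + 2a : dₘₘ.
module OddExcess (m a : ℕ) (a≤m : a ≤ m) (1≤m : 1 ≤ m) where
  open DesignKit m a a≤m

  ℓ : ℕ
  ℓ = suc (k + (a + a))

  cellX cell-dmm : BlockCell
  cellX = ⟨ false , m ∣ false , suc m ⟩
  cell-dmm = ⟨ true , m ∣ true , m ⟩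

  cellD : ℕ → BlockCell
  cellD t = ⟨ true , t ∣ true , t ⟩

  cellB cellC : ℕ → BlockCell
  cellB u = ⟨ false , u ∣ true , w + u ⟩
  cellC u = ⟨ true , w + u ∣ false , 1 + u ⟩

  cellOf : ℕ → BlockCell
  cellOf t = if t <ᵇ k then (if t == m then cellX else (if t <ᵇ w then cellD t else cellA t))
             else (if t <ᵇ (k + a) then cellB (t ∸ k) else (if t <ᵇ (k + (a + a)) then cellC (t ∸ (k + a)) else cell-dmm))

  cellOf-X : cellOf m ≡ cellX
  cellOf-X rewrite <ᵇ-true m<k | ==-refl m = refl

  cellOf-D : ∀ t → t < w → t ≢ m → cellOf t ≡ cellD t
  cellOf-D t t<w t≢m rewrite <ᵇ-true (<-≤-trans t<w w≤k) | ==-≢ t≢m | <ᵇ-true t<w = refl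

  cellOf-A : ∀ u → u < a → cellOf (w + u) ≡ cellA (w + u)
  cellOf-A u u<a rewrite <ᵇ-true (w+u<k u u<a) | ==-≢ (w+u≢m u) | <ᵇ-false (m≤m+n w u) = refl

  cellOf-B : ∀ u → u < a → cellOf (k + u) ≡ cellB u
  cellOf-B u u<a rewrite <ᵇ-false (m≤m+n k u) | <ᵇ-true (+-monoʳ-< k u<a) | m+n∸m≡n k u = refl

  cellOf-C : ∀ u → u < a → cellOf (k + a + u) ≡ cellC u
  cellOf-C u u<a
    rewrite <ᵇ-false (≤-trans (m≤m+n k a) (m≤m+n (k + a) u)) | <ᵇ-false {k + a + u} {k + a} (m≤m+n (k + a) u)
          | <ᵇ-true (subst (k + a + u <_) (+-assoc k a a) (+-monoʳ-< (k + a) u<a)) | m+n∸m≡n (k + a) u = refl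

  cellOf-dmm : cellOf (k + (a + a)) ≡ cell-dmm
  cellOf-dmm
    rewrite <ᵇ-false (m≤m+n k (a + a)) | <ᵇ-false {k + (a + a)} {k + a} (subst (k + a ≤_) (+-assoc k a a) (m≤m+n (k + a) a))
          | <ᵇ-false {k + (a + a)} {k + (a + a)} ≤-refl = refl

  data Piece (t : ℕ) : Set where
    pieceX : t ≡ m → Piece t
    pieceD : t < w → t ≢ m → Piece t
    pieceA : ∀ u → u < a → t ≡ w + u → Piece t
    pieceB : ∀ u → u < a → t ≡ k + u → Piece t
    pieceC : ∀ u → u < a → t ≡ k + a + u → Piece t
    piece-dmm : t ≡ k + (a + a) → Piece t

  piece : ∀ t → t < ℓ → Piece t
  piece t t<ℓ with below-or-above k t
  piece t t<ℓ | inj₁ t<k with t ≟ m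
  ... | yes t≡m = pieceX t≡m
  ... | no t≢m with below-or-above w t
  ...   | inj₁ t<w = pieceD t<w t≢m
  ...   | inj₂ (u , t≡) = pieceA u (offset< t≡ (subst (t <_) (sym w+a≡k) t<k)) t≡
  piece t t<ℓ | inj₂ (v , t≡) with below-or-above (k + a) t
  ... | inj₁ t<k+a = pieceB v (offset< t≡ t<k+a) t≡
  ... | inj₂ (u , t≡′) with below-or-above (k + (a + a)) t
  ...   | inj₁ t<k+2a = pieceC u (offset< t≡′ (subst (t <_) (sym (+-assoc k a a)) t<k+2a)) t≡′
  ...   | inj₂ (z , t≡″) with offset< {k + (a + a)} {t} {1} {z} t≡″ (subst (t <_) (+-comm 1 (k + (a + a))) t<ℓ)
  ...     | s≤s z≤n = piece-dmm (trans t≡″ (+-identityʳ _))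

  rowLabel colLabel : Bool → ℕ → ℕ
  rowLabel false i = if i <ᵇ a then k + i else i
  rowLabel true i = if i == m then k + (a + a) else (if i <ᵇ w then i else k + a + (i ∸ w))
  colLabel false j = if j == suc m then m else (if j == 0 then k ∸ 1 else (if j <ᵇ suc a then k + a + (j ∸ 1) else j ∸ 1))
  colLabel true j = if j == m then k + (a + a) else (if j <ᵇ w then j else k + (j ∸ w))

  Labelled : ℕ → BlockCell → Set
  Labelled = LabelledCell m rowLabel colLabel symbolLabel

  symbol-cellX : symbolAt m cellX ≡ evenSymbol m m
  symbol-cellX = trans (blockSymbol-regular m false m false (suc m) regular) (cong (λ z → 2 * (z % k) + 0) (regroup m))
    where
    regular : isSpecialCell m false m false (suc m) ≡ false
    regular rewrite ==-≢ {m} {0} (λ e → <⇒≢ 1≤m (sym e)) = refl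
    regroup : ∀ m → m + 0 + suc m ≡ 2 * m + 1
    regroup = solve-∀

  colLabel-X : colLabel false (suc m) ≡ m
  colLabel-X rewrite ==-refl (suc m) = refl

  labelledX : Labelled m cellX
  labelledX = record
    { rowIndex<K = m<k
    ; colIndex<K = subst (suc m <_) (cong (λ z → suc (m + z)) (sym (+-identityʳ m))) (s≤s (m<m+n m 1≤m))
    ; rowLabel≡ = if-false (<ᵇ-false a≤m)
    ; colLabel≡ = colLabel-X
    ; symbolLabel≡ = trans (cong symbolLabel symbol-cellX) (symbolLabel-even m m<k) }

  symbol-cellD : ∀ t → t ≢ m → symbolAt m (cellD t) ≡ evenSymbol m t
  symbol-cellD t t≢m = trans (blockSymbol-regular m true t true t regular) (cong (λ z → 2 * (z % k) + 0) (regroup t))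
    where
    regular : isSpecialCell m true t true t ≡ false
    regular rewrite ==-≢ t≢m = refl
    regroup : ∀ t → t + 1 + t ≡ 2 * t + 1
    regroup = solve-∀

  labelledD : ∀ t → t < w → t ≢ m → Labelled t (cellD t)
  labelledD t t<w t≢m = record
    { rowIndex<K = <-≤-trans t<w w≤k
    ; colIndex<K = <-≤-trans t<w w≤k
    ; rowLabel≡ = labels
    ; colLabel≡ = labels
    ; symbolLabel≡ = trans (cong symbolLabel (symbol-cellD t t≢m)) (symbolLabel-even t (<-≤-trans t<w w≤k)) }
    where
    labels : ∀ {x y} → (if t == m then x else (if t <ᵇ w then t else y)) ≡ t
    labels rewrite ==-≢ t≢m | <ᵇ-true t<w = refl

  colLabel-A : ∀ u → u < a → colLabel false (suc (w + u) % k) ≡ w + u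
  colLabel-A u u<a with m≤n⇒m<n∨m≡n (w+u<k u u<a)
  ... | inj₁ w+u+1<k
    rewrite m<n⇒m%n≡m w+u+1<k | ==-≢ {suc (w + u)} {suc m} (w+u≢m u ∘ suc-injective)
          | <ᵇ-false {suc (w + u)} {suc a} (s≤s (≤-trans (<⇒≤ a<w) (m≤m+n w u))) = refl
  ... | inj₂ w+u+1≡k = begin
    colLabel false (suc (w + u) % k) ≡⟨ cong (colLabel false) (trans (cong (_% k) w+u+1≡k) (n%n≡0 k)) ⟩
    k ∸ 1                            ≡⟨ cong (_∸ 1) w+u+1≡k ⟨
    w + u                            ∎
    where open ≡-Reasoning

  labelledA : ∀ u → u < a → Labelled (w + u) (cellA (w + u))
  labelledA u u<a = record
    { rowIndex<K = w+u<k u u<a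
    ; colIndex<K = m%n<n (suc (w + u)) k
    ; rowLabel≡ = if-false (<ᵇ-false (<⇒≤ (<-≤-trans a<w (m≤m+n w u))))
    ; colLabel≡ = colLabel-A u u<a
    ; symbolLabel≡ = trans (cong symbolLabel (symbol-cellA u)) (symbolLabel-even (w + u) (w+u<k u u<a)) }

  symbol-cellB : ∀ u → symbolAt m (cellB u) ≡ oddSymbol (2 * u)
  symbol-cellB u = trans (blockSymbol-regular m false u true (w + u) regular) (cong (λ z → 2 * (z % k) + 1) (regroup u w))
    where
    regular : isSpecialCell m false u true (w + u) ≡ false
    regular rewrite ==-≢ (w+u≢m u) = ∧-zeroʳ (u == 0)
    regroup : ∀ u w → u + 0 + (w + u) ≡ w + 2 * u
    regroup = solve-∀

  labelledB : ∀ u → u < a → Labelled (k + u) (cellB u)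
  labelledB u u<a = record
    { rowIndex<K = u<k u u<a
    ; colIndex<K = w+u<k u u<a
    ; rowLabel≡ = if-true (<ᵇ-true u<a)
    ; colLabel≡ = colLabel-B
    ; symbolLabel≡ = trans (cong symbolLabel (symbol-cellB u)) (trans (symbolLabel-odd (2 * u) (2u<k u u<a)) (oddLabel-2u u u<a)) }
    where
    colLabel-B : colLabel true (w + u) ≡ k + u
    colLabel-B rewrite ==-≢ (w+u≢m u) | <ᵇ-false (m≤m+n w u) | m+n∸m≡n w u = refl

  symbol-cellC : ∀ u → symbolAt m (cellC u) ≡ oddSymbol (2 * u + 1)
  symbol-cellC u = trans (blockSymbol-regular m true (w + u) false (1 + u) regular) (cong (λ z → 2 * (z % k) + 1) (regroup u w))
    where
    regular : isSpecialCell m true (w + u) false (1 + u) ≡ false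
    regular rewrite ==-≢ (w+u≢m u) = refl
    regroup : ∀ u w → w + u + 0 + (1 + u) ≡ w + (2 * u + 1)
    regroup = solve-∀

  labelledC : ∀ u → u < a → Labelled (k + a + u) (cellC u)
  labelledC u u<a = record
    { rowIndex<K = w+u<k u u<a
    ; colIndex<K = 1+u<k u u<a
    ; rowLabel≡ = rowLabel-C
    ; colLabel≡ = colLabel-C
    ; symbolLabel≡ = trans (cong symbolLabel (symbol-cellC u)) (trans (symbolLabel-odd (2 * u + 1) (2u+1<k u u<a)) (oddLabel-2u+1 u u<a)) }
    where
    rowLabel-C : rowLabel true (w + u) ≡ k + a + u
    rowLabel-C rewrite ==-≢ (w+u≢m u) | <ᵇ-false (m≤m+n w u) | m+n∸m≡n w u = refl
    colLabel-C : colLabel false (1 + u) ≡ k + a + u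
    colLabel-C rewrite ==-≢ {suc u} {suc m} (<⇒≢ (<-≤-trans u<a a≤m) ∘ suc-injective) | <ᵇ-true {suc u} {suc a} (s≤s u<a) = refl

  dmm-special : isSpecialCell m true m true m ≡ true
  dmm-special = isSpecialCell⇐ m true true

  symbol-dmm : symbolAt m cell-dmm ≡ K m
  symbol-dmm = blockSymbol-special m true m true m dmm-special

  oddSymbol-m+a : oddSymbol (m + a) ≡ K m
  oddSymbol-m+a = begin
    2 * ((w + (m + a)) % k) + 1 ≡⟨ cong (λ z → 2 * (z % k) + 1) (trans (regroup w m a) (cong (m +_) w+a≡k)) ⟩
    2 * ((m + k) % k) + 1       ≡⟨ cong (λ z → 2 * z + 1) (trans ([m+n]%n≡m%n m k) (m<n⇒m%n≡m m<k)) ⟩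
    2 * m + 1                   ≡⟨ K≡2m+1 m ⟨
    K m                         ∎
    where
    open ≡-Reasoning
    regroup : ∀ w m a → w + (m + a) ≡ m + (w + a)
    regroup = solve-∀

  labelled-dmm : Labelled (k + (a + a)) cell-dmm
  labelled-dmm = record
    { rowIndex<K = m<k
    ; colIndex<K = m<k
    ; rowLabel≡ = if-true (==-refl m)
    ; colLabel≡ = if-true (==-refl m)
    ; symbolLabel≡ = trans (cong symbolLabel (trans symbol-dmm (sym oddSymbol-m+a)))
                           (trans (symbolLabel-odd (m + a) (subst (m + a <_) w+a≡k (+-monoˡ-< a m<w))) oddLabel-m+a) }

  labelled : ∀ t → t < ℓ → Labelled t (cellOf t)
  labelled t t<ℓ with piece t t<ℓ
  ... | pieceX refl = subst (Labelled m) (sym cellOf-X) labelledX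
  ... | pieceD t<w t≢m = subst (Labelled t) (sym (cellOf-D t t<w t≢m)) (labelledD t t<w t≢m)
  ... | pieceA u u<a refl = subst (Labelled (w + u)) (sym (cellOf-A u u<a)) (labelledA u u<a)
  ... | pieceB u u<a refl = subst (Labelled (k + u)) (sym (cellOf-B u u<a)) (labelledB u u<a)
  ... | pieceC u u<a refl = subst (Labelled (k + a + u)) (sym (cellOf-C u u<a)) (labelledC u u<a)
  ... | piece-dmm refl = subst (Labelled (k + (a + a))) (sym cellOf-dmm) labelled-dmm

  k≤ℓ : k ≤ ℓ
  k≤ℓ = ≤-trans (m≤m+n k (a + a)) (n≤1+n _)

  k+u<ℓ : ∀ u → u < a → k + u < ℓ
  k+u<ℓ u u<a = s≤s (+-monoʳ-≤ k (≤-trans (<⇒≤ u<a) (m≤m+n a a)))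

  k+a+u<ℓ : ∀ u → u < a → k + a + u < ℓ
  k+a+u<ℓ u u<a = s≤s (subst (k + a + u ≤_) (+-assoc k a a) (+-monoʳ-≤ (k + a) (<⇒≤ u<a)))

  lowerRows-covered : ∀ i → i < k → Σ ℕ λ t → t < ℓ × rowBlock (cellOf t) ≡ true × rowIndex (cellOf t) ≡ i
  lowerRows-covered i i<k with i ≟ m
  ... | yes refl = k + (a + a) , ≤-refl , cong rowBlock cellOf-dmm , cong rowIndex cellOf-dmm
  ... | no i≢m with below-or-above w i
  ...   | inj₁ i<w = i , <-≤-trans i<k k≤ℓ , cong rowBlock (cellOf-D i i<w i≢m) , cong rowIndex (cellOf-D i i<w i≢m)
  ...   | inj₂ (u , refl) = k + a + u , k+a+u<ℓ u u<a , cong rowBlock (cellOf-C u u<a) , cong rowIndex (cellOf-C u u<a)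
    where
    u<a : u < a
    u<a = offset< refl (subst (w + u <_) (sym w+a≡k) i<k)

  rightColumns-covered : ∀ j → j < k → Σ ℕ λ t → t < ℓ × colBlock (cellOf t) ≡ true × colIndex (cellOf t) ≡ j
  rightColumns-covered j j<k with j ≟ m
  ... | yes refl = k + (a + a) , ≤-refl , cong colBlock cellOf-dmm , cong colIndex cellOf-dmm
  ... | no j≢m with below-or-above w j
  ...   | inj₁ j<w = j , <-≤-trans j<k k≤ℓ , cong colBlock (cellOf-D j j<w j≢m) , cong colIndex (cellOf-D j j<w j≢m)
  ...   | inj₂ (u , refl) = k + u , k+u<ℓ u u<a , cong colBlock (cellOf-B u u<a) , cong colIndex (cellOf-B u u<a)
    where
    u<a : u < a
    u<a = offset< refl (subst (w + u <_) (sym w+a≡k) j<k)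

  evenSymbols : ∀ x → x < k → symbolAt m (cellOf x) ≡ evenSymbol m x
  evenSymbols x x<k with piece x (<-≤-trans x<k k≤ℓ)
  ... | pieceX refl = trans (cong (symbolAt m) cellOf-X) symbol-cellX
  ... | pieceD x<w x≢m = trans (cong (symbolAt m) (cellOf-D x x<w x≢m)) (symbol-cellD x x≢m)
  ... | pieceA u u<a refl = trans (cong (symbolAt m) (cellOf-A u u<a)) (symbol-cellA u)
  ... | pieceB u u<a refl = ⊥-elim (<⇒≱ x<k (m≤m+n k u))
  ... | pieceC u u<a refl = ⊥-elim (<⇒≱ x<k (≤-trans (m≤m+n k a) (m≤m+n (k + a) u)))
  ... | piece-dmm refl = ⊥-elim (<⇒≱ x<k (m≤m+n k (a + a)))

  design : BlockDesign m ℓ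
  design = record
    { cell = cellOf ; rowLabel = rowLabel ; colLabel = colLabel ; symbolLabel = symbolLabel ; labelled = labelled
    ; lowerRows-covered = lowerRows-covered ; rightColumns-covered = rightColumns-covered ; K≤ℓ = k≤ℓ
    ; evenSymbols = evenSymbols
    ; corner-blocked = inj₁ (k + (a + a) , ≤-refl , trans (cong (symbolAt m) cellOf-dmm) symbol-dmm) }

maximal-K+2a+1 : ∀ m a → a ≤ m → 1 ≤ m → HasMaximalPTOfLength (Mstar m) (K m + suc (a + a))
maximal-K+2a+1 m a a≤m 1≤m = subst (HasMaximalPTOfLength (Mstar m)) (sym (+-suc (K m) (a + a)))
  (BlockDesign⇒maximal (OddExcess.design m a a≤m 1≤m))

-- The cells (row | column), each line given by its block and its index (u < a, w′ = w ∸ 1):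
--   t < w         : (second (t + 2m) mod K | second t + 1)      t = w + u : cellA (w + u)
--   t = K + u     : (second w′ + u | first 1 + u)                t = K + a + u : (first u | second (w + u + 1) mod K)
-- The cell t = w + a ∸ 1 covers the first column, so the corner a₀₀ is blocked.
module EvenExcess (m a : ℕ) (a≤m : a ≤ m) (1≤a : 1 ≤ a) where
  open DesignKit m a a≤m

  1≤m : 1 ≤ m
  1≤m = ≤-trans 1≤a a≤m

  ℓ : ℕ
  ℓ = k + (a + a)

  w′ : ℕ
  w′ = w ∸ 1

  w′+1≡w : suc w′ ≡ w
  w′+1≡w = m+[n∸m]≡n 0<w

  w′+a≡2m : w′ + a ≡ 2 * m
  w′+a≡2m = suc-injective (trans (cong (_+ a) w′+1≡w) w+a≡k)

  w<k : w < k
  w<k = subst (w <_) w+a≡k (m<m+n w 1≤a)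

  cellD : ℕ → BlockCell
  cellD t = ⟨ true , (t + 2 * m) % k ∣ true , suc t ⟩

  cellC cellB : ℕ → BlockCell
  cellC u = ⟨ true , w′ + u ∣ false , suc u ⟩
  cellB u = ⟨ false , u ∣ true , suc (w + u) % k ⟩

  cellOf : ℕ → BlockCell
  cellOf t = if t <ᵇ k then (if t <ᵇ w then cellD t else cellA t)
             else (if t <ᵇ (k + a) then cellC (t ∸ k) else cellB (t ∸ (k + a)))

  cellOf-D : ∀ t → t < w → cellOf t ≡ cellD t
  cellOf-D t t<w rewrite <ᵇ-true (<-trans t<w w<k) | <ᵇ-true t<w = refl

  cellOf-A : ∀ u → u < a → cellOf (w + u) ≡ cellA (w + u)
  cellOf-A u u<a rewrite <ᵇ-true (w+u<k u u<a) | <ᵇ-false (m≤m+n w u) = refl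

  cellOf-C : ∀ u → u < a → cellOf (k + u) ≡ cellC u
  cellOf-C u u<a rewrite <ᵇ-false (m≤m+n k u) | <ᵇ-true (+-monoʳ-< k u<a) | m+n∸m≡n k u = refl

  cellOf-B : ∀ u → cellOf (k + a + u) ≡ cellB u
  cellOf-B u rewrite <ᵇ-false (≤-trans (m≤m+n k a) (m≤m+n (k + a) u)) | <ᵇ-false {k + a + u} {k + a} (m≤m+n (k + a) u)
                   | m+n∸m≡n (k + a) u = refl

  data Piece (t : ℕ) : Set where
    pieceD : t < w → Piece t
    pieceA : ∀ u → u < a → t ≡ w + u → Piece t
    pieceC : ∀ u → u < a → t ≡ k + u → Piece t
    pieceB : ∀ u → u < a → t ≡ k + a + u → Piece t

  piece : ∀ t → t < ℓ → Piece t
  piece t t<ℓ with below-or-above k t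
  piece t t<ℓ | inj₁ t<k with below-or-above w t
  ... | inj₁ t<w = pieceD t<w
  ... | inj₂ (u , t≡) = pieceA u (offset< t≡ (subst (t <_) (sym w+a≡k) t<k)) t≡
  piece t t<ℓ | inj₂ (v , t≡) with below-or-above (k + a) t
  ... | inj₁ t<k+a = pieceC v (offset< t≡ t<k+a) t≡
  ... | inj₂ (u , t≡′) = pieceB u (offset< t≡′ (subst (t <_) (sym (+-assoc k a a)) t<ℓ)) t≡′

  rowLabel colLabel : Bool → ℕ → ℕ
  rowLabel false i = if i <ᵇ a then k + a + i else i
  rowLabel true i = if i == (2 * m) then 0 else (if i <ᵇ w′ then suc i else k + (i ∸ w′))
  colLabel false j = if j == 0 then k ∸ 1 else (if j <ᵇ suc a then k + (j ∸ 1) else j ∸ 1)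
  colLabel true j = if j == 0 then k + a + (a ∸ 1) else (if j <ᵇ suc w then j ∸ 1 else k + a + (j ∸ suc w))

  Labelled : ℕ → BlockCell → Set
  Labelled = LabelledCell m rowLabel colLabel symbolLabel

  rowD-0 : (0 + 2 * m) % k ≡ 2 * m
  rowD-0 = m<n⇒m%n≡m ≤-refl

  rowD-suc : ∀ t → suc t < w → (suc t + 2 * m) % k ≡ t
  rowD-suc t t+1<w = trans (cong (_% k) (regroup t m)) (trans ([m+n]%n≡m%n t k) (m<n⇒m%n≡m (<-trans (<-trans (n<1+n t) t+1<w) w<k)))
    where
    regroup : ∀ t m → suc t + 2 * m ≡ t + (1 + 2 * m)
    regroup = solve-∀

  t<w′ : ∀ t → suc t < w → t < w′
  t<w′ t t+1<w = ≤-pred (subst (suc (suc t) ≤_) (sym w′+1≡w) t+1<w)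

  rowLabel-D : ∀ t → t < w → rowLabel true ((t + 2 * m) % k) ≡ t
  rowLabel-D zero _ rewrite rowD-0 | ==-refl (2 * m) = refl
  rowLabel-D (suc t) t+1<w
    rewrite rowD-suc t t+1<w | ==-≢ {t} {2 * m} (<⇒≢ (<-trans (t<w′ t t+1<w) (subst (w′ <_) w′+a≡2m (m<m+n w′ 1≤a))))
          | <ᵇ-true (t<w′ t t+1<w) = refl

  colLabel-D : ∀ t → t < w → colLabel true (suc t) ≡ t
  colLabel-D t t<w rewrite <ᵇ-true {suc t} {suc w} (s≤s t<w) = refl

  regular-D : ∀ t → t < w → isSpecialCell m true ((t + 2 * m) % k) true (suc t) ≡ false
  regular-D t t<w with suc t == m in e
  ... | false = ∧-zeroʳ _
  regular-D zero _ | true rewrite rowD-0 = trans (∧-identityʳ _)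
    (==-≢ {2 * m} {m} (λ e′ → <⇒≢ (m<m+n m 1≤m) (sym (trans (cong (m +_) (sym (+-identityʳ m))) e′))))
  regular-D (suc t) t+1<w | true rewrite rowD-suc t t+1<w = trans (∧-identityʳ _)
    (==-≢ {t} {m} (<⇒≢ (subst (t <_) (==⇒≡ e) (≤-trans (n<1+n t) (n≤1+n (suc t))))))

  symbol-cellD : ∀ t → t < w → symbolAt m (cellD t) ≡ evenSymbol m t
  symbol-cellD t t<w = trans (blockSymbol-regular m true ((t + 2 * m) % k) true (suc t) (regular-D t t<w)) (cong (λ z → 2 * z + 0) (begin
    ((t + 2 * m) % k + 1 + suc t) % k     ≡⟨ cong (_% k) (+-assoc ((t + 2 * m) % k) 1 (suc t)) ⟩
    ((t + 2 * m) % k + (1 + suc t)) % k   ≡⟨ [m%d+n]%d≡[m+n]%d (t + 2 * m) (1 + suc t) k ⟩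
    (t + 2 * m + (1 + suc t)) % k         ≡⟨ cong (_% k) (regroup t m) ⟩
    (2 * t + 1 + (1 + 2 * m)) % k         ≡⟨ [m+n]%n≡m%n (2 * t + 1) k ⟩
    (2 * t + 1) % k                       ∎))
    where
    open ≡-Reasoning
    regroup : ∀ t m → t + 2 * m + (1 + suc t) ≡ 2 * t + 1 + (1 + 2 * m)
    regroup = solve-∀

  labelledD : ∀ t → t < w → Labelled t (cellD t)
  labelledD t t<w = record
    { rowIndex<K = m%n<n (t + 2 * m) k
    ; colIndex<K = <-≤-trans (s≤s t<w) w<k
    ; rowLabel≡ = rowLabel-D t t<w
    ; colLabel≡ = colLabel-D t t<w
    ; symbolLabel≡ = trans (cong symbolLabel (symbol-cellD t t<w)) (symbolLabel-even t (<-trans t<w w<k)) }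

  colLabel-A : ∀ u → u < a → colLabel false (suc (w + u) % k) ≡ w + u
  colLabel-A u u<a with m≤n⇒m<n∨m≡n (w+u<k u u<a)
  ... | inj₁ w+u+1<k rewrite m<n⇒m%n≡m w+u+1<k | <ᵇ-false {suc (w + u)} {suc a} (s≤s (≤-trans (<⇒≤ a<w) (m≤m+n w u))) = refl
  ... | inj₂ w+u+1≡k = trans (cong (colLabel false) (trans (cong (_% k) w+u+1≡k) (n%n≡0 k))) (cong (_∸ 1) (sym w+u+1≡k))

  labelledA : ∀ u → u < a → Labelled (w + u) (cellA (w + u))
  labelledA u u<a = record
    { rowIndex<K = w+u<k u u<a
    ; colIndex<K = m%n<n (suc (w + u)) k
    ; rowLabel≡ = if-false (<ᵇ-false (<⇒≤ (<-≤-trans a<w (m≤m+n w u))))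
    ; colLabel≡ = colLabel-A u u<a
    ; symbolLabel≡ = trans (cong symbolLabel (symbol-cellA u)) (symbolLabel-even (w + u) (w+u<k u u<a)) }

  w′+u<2m : ∀ u → u < a → w′ + u < 2 * m
  w′+u<2m u u<a = subst (w′ + u <_) w′+a≡2m (+-monoʳ-< w′ u<a)

  symbol-cellC : ∀ u → symbolAt m (cellC u) ≡ oddSymbol (2 * u)
  symbol-cellC u = trans (blockSymbol-regular m true (w′ + u) false (suc u) (∧-zeroʳ ((w′ + u) == m)))
    (cong (λ z → 2 * (z % k) + 1) (trans (regroup w′ u) (cong (_+ 2 * u) w′+1≡w)))
    where
    regroup : ∀ w′ u → w′ + u + 0 + suc u ≡ suc w′ + 2 * u
    regroup = solve-∀

  labelledC : ∀ u → u < a → Labelled (k + u) (cellC u)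
  labelledC u u<a = record
    { rowIndex<K = <-trans (w′+u<2m u u<a) ≤-refl
    ; colIndex<K = 1+u<k u u<a
    ; rowLabel≡ = rowLabel-C
    ; colLabel≡ = if-true (<ᵇ-true {suc u} {suc a} (s≤s u<a))
    ; symbolLabel≡ = trans (cong symbolLabel (symbol-cellC u)) (trans (symbolLabel-odd (2 * u) (2u<k u u<a)) (oddLabel-2u u u<a)) }
    where
    rowLabel-C : rowLabel true (w′ + u) ≡ k + u
    rowLabel-C rewrite ==-≢ {w′ + u} {2 * m} (<⇒≢ (w′+u<2m u u<a)) | <ᵇ-false (m≤m+n w′ u) | m+n∸m≡n w′ u = refl

  colLabel-B : ∀ u → u < a → colLabel true (suc (w + u) % k) ≡ k + a + u
  colLabel-B u u<a with m≤n⇒m<n∨m≡n (w+u<k u u<a)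
  ... | inj₁ w+u+1<k rewrite m<n⇒m%n≡m w+u+1<k | <ᵇ-false {suc (w + u)} {suc w} (s≤s (m≤m+n w u)) | m+n∸m≡n w u = refl
  ... | inj₂ w+u+1≡k = trans (cong (colLabel true) (trans (cong (_% k) w+u+1≡k) (n%n≡0 k))) (cong (k + a +_) a∸1≡u)
    where
    a∸1≡u : a ∸ 1 ≡ u
    a∸1≡u = cong (_∸ 1) (+-cancelˡ-≡ w a (suc u) (trans w+a≡k (trans (sym w+u+1≡k) (sym (+-suc w u)))))

  column-B≢m : ∀ u → u < a → suc (w + u) % k ≢ m
  column-B≢m u u<a with m≤n⇒m<n∨m≡n (w+u<k u u<a)
  ... | inj₁ w+u+1<k = <⇒≢ (<-trans m<w (s≤s (m≤m+n w u))) ∘ sym ∘ trans (sym (m<n⇒m%n≡m w+u+1<k))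
  ... | inj₂ w+u+1≡k = <⇒≢ 1≤m ∘ trans (sym (trans (cong (_% k) w+u+1≡k) (n%n≡0 k)))

  symbol-cellB : ∀ u → u < a → symbolAt m (cellB u) ≡ oddSymbol (2 * u + 1)
  symbol-cellB u u<a = trans (blockSymbol-regular m false u true (suc (w + u) % k) regular)
    (cong (λ z → 2 * z + 1) (trans ([m+n%d]%d≡[m+n]%d (u + 0) (suc (w + u)) k) (cong (_% k) (regroup u w))))
    where
    regular : isSpecialCell m false u true (suc (w + u) % k) ≡ false
    regular = trans (cong ((u == 0) ∧_) (==-≢ (column-B≢m u u<a))) (∧-zeroʳ (u == 0))
    regroup : ∀ u w → u + 0 + suc (w + u) ≡ w + (2 * u + 1)
    regroup = solve-∀

  labelledB : ∀ u → u < a → Labelled (k + a + u) (cellB u)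
  labelledB u u<a = record
    { rowIndex<K = u<k u u<a
    ; colIndex<K = m%n<n (suc (w + u)) k
    ; rowLabel≡ = if-true (<ᵇ-true u<a)
    ; colLabel≡ = colLabel-B u u<a
    ; symbolLabel≡ = trans (cong symbolLabel (symbol-cellB u u<a))
                           (trans (symbolLabel-odd (2 * u + 1) (2u+1<k u u<a)) (oddLabel-2u+1 u u<a)) }

  labelled : ∀ t → t < ℓ → Labelled t (cellOf t)
  labelled t t<ℓ with piece t t<ℓ
  ... | pieceD t<w = subst (Labelled t) (sym (cellOf-D t t<w)) (labelledD t t<w)
  ... | pieceA u u<a refl = subst (Labelled (w + u)) (sym (cellOf-A u u<a)) (labelledA u u<a)
  ... | pieceC u u<a refl = subst (Labelled (k + u)) (sym (cellOf-C u u<a)) (labelledC u u<a)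
  ... | pieceB u u<a refl = subst (Labelled (k + a + u)) (sym (cellOf-B u)) (labelledB u u<a)

  k≤ℓ : k ≤ ℓ
  k≤ℓ = m≤m+n k (a + a)

  k+u<ℓ : ∀ u → u < a → k + u < ℓ
  k+u<ℓ u u<a = +-monoʳ-< k (<-≤-trans u<a (m≤m+n a a))

  k+a+u<ℓ : ∀ u → u < a → k + a + u < ℓ
  k+a+u<ℓ u u<a = subst (k + a + u <_) (+-assoc k a a) (+-monoʳ-< (k + a) u<a)

  a∸1<a : a ∸ 1 < a
  a∸1<a = ∸-monoʳ-< {a} {1} {0} z<s 1≤a

  w+[a∸1]+1≡k : suc (w + (a ∸ 1)) ≡ k
  w+[a∸1]+1≡k = trans (sym (+-suc w (a ∸ 1))) (trans (cong (w +_) (m+[n∸m]≡n 1≤a)) w+a≡k)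

  lowerRows-covered : ∀ i → i < k → Σ ℕ λ t → t < ℓ × rowBlock (cellOf t) ≡ true × rowIndex (cellOf t) ≡ i
  lowerRows-covered i i<k with i ≟ 2 * m
  ... | yes refl = 0 , <-≤-trans (<-trans 0<w w<k) k≤ℓ , cong rowBlock (cellOf-D 0 0<w) , trans (cong rowIndex (cellOf-D 0 0<w)) rowD-0
  ... | no i≢2m with below-or-above w′ i
  ...   | inj₁ i<w′ = suc i , <-≤-trans (<-trans i+1<w w<k) k≤ℓ , cong rowBlock (cellOf-D (suc i) i+1<w) ,
                      trans (cong rowIndex (cellOf-D (suc i) i+1<w)) (rowD-suc i i+1<w)
    where
    i+1<w : suc i < w
    i+1<w = subst (suc i <_) w′+1≡w (s≤s i<w′)
  ...   | inj₂ (u , refl) = k + u , k+u<ℓ u u<a , cong rowBlock (cellOf-C u u<a) , cong rowIndex (cellOf-C u u<a)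
    where
    u<a : u < a
    u<a = offset< refl (subst (w′ + u <_) (sym w′+a≡2m) (≤∧≢⇒< (≤-pred i<k) i≢2m))

  rightColumns-covered : ∀ j → j < k → Σ ℕ λ t → t < ℓ × colBlock (cellOf t) ≡ true × colIndex (cellOf t) ≡ j
  rightColumns-covered zero _ = k + a + (a ∸ 1) , k+a+u<ℓ (a ∸ 1) a∸1<a , cong colBlock (cellOf-B (a ∸ 1)) ,
    trans (cong colIndex (cellOf-B (a ∸ 1))) (trans (cong (_% k) w+[a∸1]+1≡k) (n%n≡0 k))
  rightColumns-covered (suc j) j+1<k with below-or-above w j
  ... | inj₁ j<w = j , <-≤-trans (<-trans j<w w<k) k≤ℓ , cong colBlock (cellOf-D j j<w) , cong colIndex (cellOf-D j j<w)
  ... | inj₂ (u , refl) = k + a + u , k+a+u<ℓ u u<a , cong colBlock (cellOf-B u) ,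
                          trans (cong colIndex (cellOf-B u)) (m<n⇒m%n≡m j+1<k)
    where
    u<a : u < a
    u<a = +-cancelˡ-< w u a (subst (w + u <_) (sym w+a≡k) (<-trans (n<1+n (w + u)) j+1<k))

  evenSymbols : ∀ x → x < k → symbolAt m (cellOf x) ≡ evenSymbol m x
  evenSymbols x x<k with piece x (<-≤-trans x<k k≤ℓ)
  ... | pieceD x<w = trans (cong (symbolAt m) (cellOf-D x x<w)) (symbol-cellD x x<w)
  ... | pieceA u u<a refl = trans (cong (symbolAt m) (cellOf-A u u<a)) (symbol-cellA u)
  ... | pieceC u u<a refl = ⊥-elim (<⇒≱ x<k (m≤m+n k u))
  ... | pieceB u u<a refl = ⊥-elim (<⇒≱ x<k (≤-trans (m≤m+n k a) (m≤m+n (k + a) u)))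

  design : BlockDesign m ℓ
  design = record
    { cell = cellOf ; rowLabel = rowLabel ; colLabel = colLabel ; symbolLabel = symbolLabel ; labelled = labelled
    ; lowerRows-covered = lowerRows-covered ; rightColumns-covered = rightColumns-covered ; K≤ℓ = k≤ℓ
    ; evenSymbols = evenSymbols
    ; corner-blocked = inj₂ (w + (a ∸ 1) , <-≤-trans (w+u<k (a ∸ 1) a∸1<a) k≤ℓ , cong colBlock (cellOf-A (a ∸ 1) a∸1<a) ,
                              trans (cong colIndex (cellOf-A (a ∸ 1) a∸1<a)) (trans (cong (_% k) w+[a∸1]+1≡k) (n%n≡0 k))) }

maximal-K+2a : ∀ m a → a ≤ m → 1 ≤ a → HasMaximalPTOfLength (Mstar m) (K m + (a + a))
maximal-K+2a m a a≤m 1≤a = BlockDesign⇒maximal (EvenExcess.design m a a≤m 1≤a)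

-- Near-omniversality

⌈ord/2⌉≡K : ∀ m → ⌈ ord m /2⌉ ≡ K m
⌈ord/2⌉≡K m = trans (cong ⌈_/2⌉ (ord≡K+K m)) (sym (n≡⌈n+n/2⌉ (K m)))

halve : ∀ j → Σ ℕ λ a → j ≡ a + a ⊎ j ≡ suc (a + a)
halve zero = 0 , inj₁ refl
halve (suc j) with halve j
... | a , inj₁ j≡ = a , inj₂ (cong suc j≡)
... | a , inj₂ j≡ = suc a , inj₁ (trans (cong suc j≡) (cong suc (sym (+-suc a a))))

a+a≤K⇒a≤m : ∀ m a → a + a ≤ K m → a ≤ m
a+a≤K⇒a≤m m a a+a≤K with a ≤? m
... | yes a≤m = a≤m
... | no a≰m = ⊥-elim (<⇒≱ (s≤s ≤-refl) (≤-trans (subst (_≤ a + a) (regroup m) (+-mono-≤ (≰⇒> a≰m) (≰⇒> a≰m))) a+a≤K))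
  where
  regroup : ∀ m → suc m + suc m ≡ suc (suc (2 * m))
  regroup = solve-∀

maximal-K+j : ∀ m j → 1 ≤ m → 1 ≤ j → j ≤ K m → HasMaximalPTOfLength (Mstar m) (K m + j)
maximal-K+j m j 1≤m 1≤j j≤K with halve j
... | a , inj₁ refl = maximal-K+2a m a (a+a≤K⇒a≤m m a j≤K) (1≤a 1≤j)
  where
  1≤a : ∀ {a} → 1 ≤ a + a → 1 ≤ a
  1≤a {suc a} _ = s≤s z≤n
... | a , inj₂ refl = maximal-K+2a+1 m a (a+a≤K⇒a≤m m a (≤-trans (n≤1+n (a + a)) j≤K)) 1≤m

near-omniversal : ∀ m → 1 ≤ m → NearOmniversal (Mstar m)
near-omniversal m 1≤m = 2 * m + 1 , (≤-reflexive (trans (⌈ord/2⌉≡K m) (K≡2m+1 m)) ,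
                                     subst (_≤ ord m) (K≡2m+1 m) (<⇒≤ (K<ord m)) ,
                                     no-maximal-of-length-K m 1≤m) , only-K
  where
  only-K : ∀ ℓ → ⌈ ord m /2⌉ ≤ ℓ → ℓ ≤ ord m → ¬ HasMaximalPTOfLength (Mstar m) ℓ → ℓ ≡ 2 * m + 1
  only-K ℓ ⌈ord/2⌉≤ℓ ℓ≤ord no-maximal with ℓ ≟ K m
  ... | yes ℓ≡K = trans ℓ≡K (K≡2m+1 m)
  ... | no ℓ≢K = ⊥-elim (no-maximal (subst (HasMaximalPTOfLength (Mstar m)) ℓ≡K+j
          (maximal-K+j m (ℓ ∸ K m) 1≤m (n≢0⇒n>0 (ℓ≢K ∘ j≡0⇒ℓ≡K)) j≤K)))
    where
    K≤ℓ : K m ≤ ℓ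
    K≤ℓ = subst (_≤ ℓ) (⌈ord/2⌉≡K m) ⌈ord/2⌉≤ℓ
    ℓ≡K+j : K m + (ℓ ∸ K m) ≡ ℓ
    ℓ≡K+j = m+[n∸m]≡n K≤ℓ
    j≡0⇒ℓ≡K : ℓ ∸ K m ≡ 0 → ℓ ≡ K m
    j≡0⇒ℓ≡K j≡0 = trans (sym ℓ≡K+j) (trans (cong (K m +_) j≡0) (+-identityʳ (K m)))
    j≤K : ℓ ∸ K m ≤ K m
    j≤K = +-cancelˡ-≤ (K m) (ℓ ∸ K m) (K m) (subst₂ _≤_ (sym ℓ≡K+j) (ord≡K+K m) ℓ≤ord)

no-transversal-of-order-2 : ¬ HasMaximalPTOfLength (Mstar 0) 2
no-transversal-of-order-2 (((r₁ , c₁) ∷ (r₂ , c₂) ∷ []) , (((r₁≢r₂ ∷ []) ∷ _ , (c₁≢c₂ ∷ []) ∷ _ , (s₁≢s₂ ∷ []) ∷ _) , _) , refl) =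
  distinct-cells r₁ c₁ r₂ c₂ r₁≢r₂ c₁≢c₂ s₁≢s₂
  where
  distinct-cells : ∀ (r₁ c₁ r₂ c₂ : Fin 2) → r₁ ≢ r₂ → c₁ ≢ c₂ → Mstar 0 r₁ c₁ ≢ Mstar 0 r₂ c₂ → ⊥
  distinct-cells zero c₁ zero c₂ r≢ c≢ s≢ = r≢ refl
  distinct-cells (suc zero) c₁ (suc zero) c₂ r≢ c≢ s≢ = r≢ refl
  distinct-cells zero zero (suc zero) zero r≢ c≢ s≢ = c≢ refl
  distinct-cells zero zero (suc zero) (suc zero) r≢ c≢ s≢ = s≢ refl
  distinct-cells zero (suc zero) (suc zero) zero r≢ c≢ s≢ = s≢ refl
  distinct-cells zero (suc zero) (suc zero) (suc zero) r≢ c≢ s≢ = c≢ refl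
  distinct-cells (suc zero) zero zero zero r≢ c≢ s≢ = c≢ refl
  distinct-cells (suc zero) zero zero (suc zero) r≢ c≢ s≢ = s≢ refl
  distinct-cells (suc zero) (suc zero) zero zero r≢ c≢ s≢ = s≢ refl
  distinct-cells (suc zero) (suc zero) zero (suc zero) r≢ c≢ s≢ = c≢ refl

maximal-of-order-2 : HasMaximalPTOfLength (Mstar 0) 1
maximal-of-order-2 = corner , blocked⇒maximal (Mstar 0) corner (([] ∷ []) , ([] ∷ []) , ([] ∷ [])) corner-blocks , refl
  where
  corner : List (Cell 2)
  corner = (zero , zero) ∷ []
  corner-blocks : Blocked (Mstar 0) corner
  corner-blocks zero c r∉ c∉ = ⊥-elim (r∉ (here refl))
  corner-blocks (suc zero) zero r∉ c∉ = ⊥-elim (c∉ (here refl))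
  corner-blocks (suc zero) (suc zero) r∉ c∉ = here refl

near-omniversal-of-order-2 : NearOmniversal (Mstar 0)
near-omniversal-of-order-2 = 2 , (s≤s z≤n , s≤s (s≤s z≤n) , no-transversal-of-order-2) , only-2
  where
  only-2 : ∀ ℓ → ⌈ ord 0 /2⌉ ≤ ℓ → ℓ ≤ ord 0 → ¬ HasMaximalPTOfLength (Mstar 0) ℓ → ℓ ≡ 2
  only-2 1 _ _ no-maximal = ⊥-elim (no-maximal maximal-of-order-2)
  only-2 2 _ _ _ = refl
  only-2 (suc (suc (suc _))) _ (s≤s (s≤s ())) _

theorem3p3 : (m : ℕ) →
    (IsLatin (Mstar m) × NearOmniversal (Mstar m)) ×
    (1 ≤ m → ¬ HasMaximalPTOfLength (Mstar m) (2 * m + 1))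
theorem3p3 zero = (Mstar-latin 0 , near-omniversal-of-order-2) , λ ()
theorem3p3 (suc m) = (Mstar-latin (suc m) , near-omniversal (suc m) z<s) , no-maximal-of-length-K (suc m)
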